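{- Let $r\in\mathbb{Z}$, $\ell\in\mathbb{N}$, and let $(d_1,\ldots,d_\ell)$ be a Ferrers sequence. If $1\le r\le\partial(d_1,\ldots,d_\ell)$, then $$R_r(d_1,\ldots,d_\ell;q)=R_r(d_1,\ldots,d_{\ell-1};q)\,q^{d_\ell}+\sum_{j=1}^{d_\ell}R_{r-1}(d_2-1,\ldots,d_{\ell-1}-1,j-1;q)\,q^{d_\ell-j}.$$ Moreover, $R_0(d_1,\ldots,d_\ell;q)=q^{d_1+\cdots+d_\ell}$, and $R_r(d_1,\ldots,d_\ell;q)=0$ if $r>\partial(d_1,\ldots,d_\ell)$ or $r<0$.
   Context: $\mathbb{N}$ denotes the positive integers. A Ferrers diagram is a finite set $\mathcal{F}\subseteq\mathbb{N}\times\mathbb{N}$ such that $(i,j)\in\mathcal{F}$ implies $(s,t)\in\mathcal{F}$ for all $1\le s\le i$, $1\le t\le j$. The $i$-th diagonal is $\Delta_i=\{(s,i-s+1):s\in\{1,\ldots,i\}\}$. A placement of non-attacking rooks is a set of cells no two sharing a row or column index; $\mathrm{NAR}(\mathcal{F},r)$ is the set of such placements $P\subseteq\mathcal{F}$ with $|P|=r$. For $P$, $\mathrm{ATK}(P)=\bigcup_{(a,b)\in P}\big(\{(s,b):1\le s\le a\}\cup\{(a,t):1\le t\le b\}\big)$ and $\mathrm{inv}(\mathcal{F},P)=|\mathcal{F}\setminus\mathrm{ATK}(P)|$. The $r$-th $q$-rook polynomial is $R_r(\mathcal{F};q)=\sum_{P\in\mathrm{NAR}(\mathcal{F},r)}q^{\mathrm{inv}(\mathcal{F},P)}$,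 with $R_r=0$ if $r<0$ or $\mathrm{NAR}(\mathcal{F},r)=\emptyset$, and $R_0(\mathcal{F};q)=q^{|\mathcal{F}|}$. A sequence $(d_1,\ldots,d_\ell)$ of non-negative integers is a Ferrers sequence if it is $(0,\ldots,0)$ or there is $r\in\{1,\ldots,\ell\}$ with $d_i=i$ for $1\le i\le r$ and $d_r\ge d_{r+1}\ge\cdots\ge d_\ell$; these are exactly the sequences $(|\Delta_i\cap\mathcal{F}|)_{i\le\ell}$ of Ferrers diagrams $\mathcal{F}$ with $\Delta_i\cap\mathcal{F}=\emptyset$ for $i>\ell$. For a Ferrers sequence, $R_r(d_1,\ldots,d_\ell;q)$ denotes $R_r(\mathcal{F};q)$ for any Ferrers diagram $\mathcal{F}$ with $|\Delta_i\cap\mathcal{F}|=d_i$ for $i\le\ell$ and $|\Delta_i\cap\mathcal{F}|=0$ for $i>\ell$ (this does not depend on the choice of $\mathcal{F}$), and $\partial(d_1,\ldots,d_\ell)=\max\{r:\mathrm{NAR}(\mathcal{F},r)\neq\emptyset\}=\max_i d_i$. The empty sequence corresponds to the empty diagram. -}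

module Defs where

open import Data.Nat using (ℕ; zero; suc; _+_; _∸_; _≤_; _<_; _⊔_; _≡ᵇ_; _≤ᵇ_; _<ᵇ_)
open import Data.Integer using (ℤ; +_; -[1+_])
open import Data.Bool using (Bool; true; false; _∧_; _∨_; not; if_then_else_)
open import Data.List using (List; []; _∷_; length; filter; map; upTo; concat; foldr; _++_; [_])
open import Data.Product using (_×_; _,_; proj₁; proj₂; Σ; ∃)
open import Data.Sum using (_⊎_)
open import Relation.Binary.PropositionalEquality using (_≡_)
open import Relation.Nullary.Decidable using (does)
open import Data.Nat using (_≟_)
open import Relation.Unary using (Pred)

-- Sequences / row lengths, 1-indexed lookup (0 outside the range)

at : List ℕ → ℕ → ℕ
at []       _             = 0
at (x ∷ xs) zero          = 0
at (x ∷ xs) (suc zero)    = x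
at (x ∷ xs) (suc (suc n)) = at xs (suc n)

-- A finite set F ⊆ ℕ⁺ × ℕ⁺ that is a Ferrers diagram
-- is represented by its list of row lengths (λ₁, λ₂, …): the cell (s,t)
-- belongs to F iff 1 ≤ t ≤ λ_s.  Such a set is downward closed iff the
-- row lengths are weakly decreasing; every finite Ferrers diagram arises.

IsFerrers : List ℕ → Set
IsFerrers λs = ∀ i → 1 ≤ i → at λs (suc i) ≤ at λs i

Cell : Set
Cell = ℕ × ℕ

inF : List ℕ → Cell → Bool
inF λs (s , t) = (1 ≤ᵇ t) ∧ (t ≤ᵇ at λs s)

oneTo : ℕ → List ℕ
oneTo n = map suc (upTo n)

cellsFrom : ℕ → List ℕ → List Cell
cellsFrom i []         = []
cellsFrom i (a ∷ λs)   = map (λ t → (i , t)) (oneTo a) ++ cellsFrom (suc i) λs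

cells : List ℕ → List Cell
cells = cellsFrom 1

-- all subsets of a (repetition-free) list, as sublists
sublists : {A : Set} → List A → List (List A)
sublists []       = [] ∷ []
sublists (x ∷ xs) = map (x ∷_) (sublists xs) ++ sublists xs

count : {A : Set} → (A → Bool) → List A → ℕ
count p []       = 0
count p (x ∷ xs) = (if p x then 1 else 0) + count p xs

allB : {A : Set} → (A → Bool) → List A → Bool
allB p []       = true
allB p (x ∷ xs) = p x ∧ allB p xs

anyB : {A : Set} → (A → Bool) → List A → Bool
anyB p []       = false
anyB p (x ∷ xs) = p x ∨ anyB p xs

nonAttacking : List Cell → Bool
nonAttacking []              = true
nonAttacking ((a , b) ∷ P)   =
  allB (λ c → not (a ≡ᵇ proj₁ c) ∧ not (b ≡ᵇ proj₂ c)) P ∧ nonAttacking P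

attacked : List Cell → Cell → Bool
attacked P (s , t) =
  anyB (λ c → ((t ≡ᵇ proj₂ c) ∧ (s ≤ᵇ proj₁ c)) ∨ ((s ≡ᵇ proj₁ c) ∧ (t ≤ᵇ proj₂ c))) P

inv : List ℕ → List Cell → ℕ
inv λs P = count (λ c → not (attacked P c)) (cells λs)

-- Polynomials in q with natural coefficients, as coefficient functions.

Poly : Set
Poly = ℕ → ℕ

_≈ₚ_ : Poly → Poly → Set
p ≈ₚ p' = ∀ k → p k ≡ p' k

0ₚ : Poly
0ₚ _ = 0

_⊕_ : Poly → Poly → Poly
(p ⊕ p') k = p k + p' k

qpow : ℕ → Poly
qpow n k = if n ≡ᵇ k then 1 else 0

shift : ℕ → Poly → Poly
shift n p k = if k <ᵇ n then 0 else p (k ∸ n)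

sumₚ : ℕ → (ℕ → Poly) → Poly
sumₚ zero    f = 0ₚ
sumₚ (suc n) f = sumₚ n f ⊕ f (suc n)

-- q-rook polynomials.  Coefficient of q^k in R_r(F;q) is the number of
-- P ∈ NAR(F,r) with inv(F,P) = k (P ranges over subsets of F).

Rℕ : ℕ → List ℕ → Poly
Rℕ r λs k = count (λ P → (length P ≡ᵇ r) ∧ nonAttacking P ∧ (inv λs P ≡ᵇ k))
                  (sublists (cells λs))

R : ℤ → List ℕ → Poly
R (+ n)    λs = Rℕ n λs
R -[1+ n ] λs = 0ₚ

diag : List ℕ → ℕ → ℕ
diag λs i = count (λ s → inF λs (s , suc i ∸ s)) (oneTo i)

Realizes : List ℕ → List ℕ → Set
Realizes λs d = ∀ i → 1 ≤ i → diag λs i ≡ at d i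

IsFerrersSeq : List ℕ → Set
IsFerrersSeq d =
  (∀ i → at d i ≡ 0)
  ⊎ Σ ℕ (λ r → (1 ≤ r) × (r ≤ length d)
           × (∀ i → 1 ≤ i → i ≤ r → at d i ≡ i)
           × (∀ i → r ≤ i → i < length d → at d (suc i) ≤ at d i))

∂ : List ℕ → ℕ
∂ = foldr _⊔_ 0

sumL : List ℕ → ℕ
sumL = foldr _+_ 0

-- (d₂-1, …, d_{ℓ-1}-1, j-1) from ds = (d₁,…,d_{ℓ-1})
tailPred : List ℕ → List ℕ
tailPred []       = []
tailPred (_ ∷ xs) = map (_∸ 1) xs

gseq : List ℕ → ℕ → List ℕ
gseq ds j = tailPred ds ++ [ j ∸ 1 ]

module Submission where

-- Let (a , b) be a corner of F on its last diagonal ℓ.  Splitting rook placements by whether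
-- they use the corner gives R_r(F) = q R_r(F ∖ (a , b)) + R_{r-1}(H), H being F with row a and
-- column b struck out: a placement avoiding the corner leaves it unattacked, while one through
-- it attacks all of row a and column b and otherwise lives on a copy of H.  Removing the cells
-- of diagonal ℓ one corner at a time, the corner taken while j cells remain yields an H with
-- diagonals (d₂ - 1, …, d_{ℓ-1} - 1, j - 1) and contributes q^{d_ℓ - j} R_{r-1}(H); what is left
-- at the end has diagonals (d₁, …, d_{ℓ-1}).  Since both sequences are smaller in the measure
-- Σ dᵢ + ℓ, induction shows that R_r depends only on the diagonal sequence, and the same peeling
-- gives R_0 = q^{Σ dᵢ} and R_r = 0 for r > max dᵢ.

open import Defs
open import Data.Nat using (ℕ; zero; suc; pred; _+_; _∸_; _≤_; _<_; z≤n; s≤s; _≡ᵇ_; _≤ᵇ_; _<ᵇ_; _≟_; _≤?_; _<?_)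
open import Data.Nat.Properties
open import Data.Bool using (Bool; true; false; _∧_; _∨_; not; if_then_else_; T; T?)
open import Data.Bool.Properties using (∧-zeroʳ; ∨-zeroʳ)
open import Data.List using (List; []; _∷_; length; map; _++_; _∷ʳ_; [_]; upTo; applyUpTo; filterᵇ; initLast; _∷ʳ′_)
open import Data.List.Properties using (length-map; length-++; map-upTo; map-∘)
open import Data.List.Membership.Propositional using (_∈_)
open import Data.List.Membership.Propositional.Properties
  using (∈-map⁺; ∈-map⁻; ∈-++⁺ˡ; ∈-++⁺ʳ; ∈-++⁻; ∈-upTo⁺; ∈-upTo⁻; ∈-filter⁺; ∈-filter⁻)
open import Data.List.Membership.Propositional.Properties.WithK using (unique∧set⇒bag)
open import Data.List.Relation.Binary.BagAndSetEquality using (∼bag⇒↭)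
open import Data.List.Relation.Binary.Permutation.Propositional as ↭ using (_↭_)
open import Data.List.Relation.Binary.Permutation.Propositional.Properties using (↭-length)
open import Data.List.Relation.Binary.Subset.Propositional using (_⊆_)
open import Data.List.Relation.Unary.Any using (here; there)
import Data.List.Relation.Unary.All as All
open import Data.List.Relation.Unary.Unique.Propositional using (Unique; []; _∷_)
import Data.List.Relation.Unary.Unique.Propositional.Properties as Unique
open import Data.Product using (_×_; _,_; proj₁; proj₂; Σ)
open import Data.Sum using (_⊎_; inj₁; inj₂; [_,_]′)
open import Data.Empty using (⊥; ⊥-elim)
open import Function.Bundles using (mk⇔)
open import Function.Base using (_∘_)
open import Relation.Nullary using (¬_; yes; no)
open import Relation.Binary.Definitions using (tri<; tri≈; tri>)
open import Relation.Binary.PropositionalEquality using (_≡_; _≢_; refl; sym; trans; cong; cong₂; subst; subst₂; module ≡-Reasoning)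
open import Algebra.Properties.CommutativeSemigroup +-commutativeSemigroup using (interchange)
open import Induction.WellFounded using (WellFounded; Acc; acc)
import Relation.Binary.Construct.On as On
open import Data.Nat.Induction using (<-wellFounded)

open ≡-Reasoning

ind : Bool → ℕ
ind b = if b then 1 else 0

count-++ : {A : Set} (p : A → Bool) (xs ys : List A) → count p (xs ++ ys) ≡ count p xs + count p ys
count-++ p []       ys = refl
count-++ p (x ∷ xs) ys = trans (cong (ind (p x) +_) (count-++ p xs ys)) (sym (+-assoc (ind (p x)) _ _))

count-map : {A B : Set} (p : B → Bool) (f : A → B) (xs : List A) → count p (map f xs) ≡ count (λ x → p (f x)) xs
count-map p f []       = refl
count-map p f (x ∷ xs) = cong (ind (p (f x)) +_) (count-map p f xs)

count-cong : {A : Set} {p q : A → Bool} (xs : List A) → (∀ {x} → x ∈ xs → p x ≡ q x) → count p xs ≡ count q xs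
count-cong []       h = refl
count-cong (x ∷ xs) h = cong₂ (λ b n → ind b + n) (h (here refl)) (count-cong xs (λ m → h (there m)))

count-false : {A : Set} {p : A → Bool} (xs : List A) → (∀ x → p x ≡ false) → count p xs ≡ 0
count-false []       h = refl
count-false (x ∷ xs) h rewrite h x = count-false xs h

count-↭ : {A : Set} (p : A → Bool) {xs ys : List A} → xs ↭ ys → count p xs ≡ count p ys
count-↭ p ↭.refl         = refl
count-↭ p (↭.prep x q)   = cong (ind (p x) +_) (count-↭ p q)
count-↭ p (↭.swap {xs = xs} {ys = ys} x y q) = begin
  ind (p x) + (ind (p y) + count p xs) ≡⟨ sym (+-assoc (ind (p x)) _ _) ⟩
  ind (p x) + ind (p y) + count p xs   ≡⟨ cong₂ _+_ (+-comm (ind (p x)) _) (count-↭ p q) ⟩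
  ind (p y) + ind (p x) + count p ys   ≡⟨ +-assoc (ind (p y)) _ _ ⟩
  ind (p y) + (ind (p x) + count p ys) ∎
count-↭ p (↭.trans q q') = trans (count-↭ p q) (count-↭ p q')

count-positive : {A : Set} {p : A → Bool} {x : A} (xs : List A) → x ∈ xs → p x ≡ true → 1 ≤ count p xs
count-positive {p = p} (x ∷ xs) (here refl) px rewrite px = s≤s z≤n
count-positive {p = p} (y ∷ xs) (there m)   px = ≤-trans (count-positive xs m px) (m≤n+m _ (ind (p y)))

count-witness : {A : Set} {p : A → Bool} (xs : List A) → 1 ≤ count p xs → Σ A λ x → x ∈ xs × p x ≡ true
count-witness {p = p} (x ∷ xs) h with p x in px
... | true  = x , here refl , px
... | false = let (y , m , py) = count-witness xs h in y , there m , py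

countSubs : {A : Set} → (List A → Bool) → List A → ℕ
countSubs p xs = count p (sublists xs)

countSubs-∷ : {A : Set} (p : List A → Bool) (x : A) (xs : List A) →
  countSubs p (x ∷ xs) ≡ countSubs (λ P → p (x ∷ P)) xs + countSubs p xs
countSubs-∷ p x xs =
  trans (count-++ p (map (x ∷_) (sublists xs)) (sublists xs))
        (cong (_+ countSubs p xs) (count-map p (x ∷_) (sublists xs)))

countSubs-map : {A B : Set} (p : List B → Bool) (f : A → B) (xs : List A) →
  countSubs p (map f xs) ≡ countSubs (λ P → p (map f P)) xs
countSubs-map p f []       = refl
countSubs-map p f (x ∷ xs) = begin
  countSubs p (f x ∷ map f xs)
    ≡⟨ countSubs-∷ p (f x) (map f xs) ⟩
  countSubs (λ P → p (f x ∷ P)) (map f xs) + countSubs p (map f xs)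
    ≡⟨ cong₂ _+_ (countSubs-map (λ P → p (f x ∷ P)) f xs) (countSubs-map p f xs) ⟩
  countSubs (λ P → p (map f (x ∷ P))) xs + countSubs (λ P → p (map f P)) xs
    ≡⟨ sym (countSubs-∷ (λ P → p (map f P)) x xs) ⟩
  countSubs (λ P → p (map f P)) (x ∷ xs) ∎

countSubs-cong : {A : Set} {p q : List A → Bool} (xs : List A) →
  (∀ P → P ⊆ xs → p P ≡ q P) → countSubs p xs ≡ countSubs q xs
countSubs-cong []       h = cong (λ b → ind b + 0) (h [] (λ ()))
countSubs-cong {p = p} {q} (x ∷ xs) h = begin
  countSubs p (x ∷ xs)
    ≡⟨ countSubs-∷ p x xs ⟩
  countSubs (λ P → p (x ∷ P)) xs + countSubs p xs
    ≡⟨ cong₂ _+_ (countSubs-cong xs (λ P P⊆ → h (x ∷ P) λ { (here e) → here e ; (there m) → there (P⊆ m) }))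
                 (countSubs-cong xs (λ P P⊆ → h P (λ m → there (P⊆ m)))) ⟩
  countSubs (λ P → q (x ∷ P)) xs + countSubs q xs
    ≡⟨ sym (countSubs-∷ q x xs) ⟩
  countSubs q (x ∷ xs) ∎

countSubs-false : {A : Set} {p : List A → Bool} (xs : List A) → (∀ P → p P ≡ false) → countSubs p xs ≡ 0
countSubs-false xs h = count-false (sublists xs) h

countSubs-avoiding : {A : Set} (p : List A → Bool) (as bs : List A) →
  (∀ P {y} → y ∈ as → y ∈ P → p P ≡ false) → countSubs p (as ++ bs) ≡ countSubs p bs
countSubs-avoiding p []       bs h = refl
countSubs-avoiding p (a ∷ as) bs h = begin
  countSubs p (a ∷ as ++ bs)
    ≡⟨ countSubs-∷ p a (as ++ bs) ⟩
  countSubs (λ P → p (a ∷ P)) (as ++ bs) + countSubs p (as ++ bs)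
    ≡⟨ cong₂ _+_ (countSubs-false (as ++ bs) (λ P → h (a ∷ P) (here refl) (here refl)))
                 (countSubs-avoiding p as bs (λ P m m' → h P (there m) m')) ⟩
  countSubs p bs ∎

PermutationInvariant : {A : Set} → (List A → Bool) → Set
PermutationInvariant p = ∀ {P Q} → P ↭ Q → p P ≡ p Q

countSubs-↭ : {A : Set} (p : List A → Bool) → PermutationInvariant p →
  {xs ys : List A} → xs ↭ ys → countSubs p xs ≡ countSubs p ys
countSubs-↭ p inv ↭.refl = refl
countSubs-↭ p inv (↭.prep {xs = xs} {ys = ys} x q) = begin
  countSubs p (x ∷ xs)
    ≡⟨ countSubs-∷ p x xs ⟩
  countSubs (λ P → p (x ∷ P)) xs + countSubs p xs
    ≡⟨ cong₂ _+_ (countSubs-↭ (λ P → p (x ∷ P)) (λ q' → inv (↭.prep x q')) q) (countSubs-↭ p inv q) ⟩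
  countSubs (λ P → p (x ∷ P)) ys + countSubs p ys
    ≡⟨ sym (countSubs-∷ p x ys) ⟩
  countSubs p (x ∷ ys) ∎
countSubs-↭ {A} p inv (↭.swap {xs = xs} {ys = ys} x y q) = begin
  countSubs p (x ∷ y ∷ xs)
    ≡⟨ countSubs-∷ p x (y ∷ xs) ⟩
  countSubs (λ P → p (x ∷ P)) (y ∷ xs) + countSubs p (y ∷ xs)
    ≡⟨ cong₂ _+_ (countSubs-∷ (λ P → p (x ∷ P)) y xs) (countSubs-∷ p y xs) ⟩
  (sub (λ P → x ∷ y ∷ P) xs + sub (x ∷_) xs) + (sub (y ∷_) xs + sub (λ P → P) xs)
    ≡⟨ cong₂ _+_ (cong₂ _+_ xy↦yx (countSubs-↭ _ (λ q' → inv (↭.prep x q')) q))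
                 (cong₂ _+_ (countSubs-↭ _ (λ q' → inv (↭.prep y q')) q) (countSubs-↭ p inv q)) ⟩
  (sub (λ P → y ∷ x ∷ P) ys + sub (x ∷_) ys) + (sub (y ∷_) ys + sub (λ P → P) ys)
    ≡⟨ interchange (sub (λ P → y ∷ x ∷ P) ys) _ _ _ ⟩
  (sub (λ P → y ∷ x ∷ P) ys + sub (y ∷_) ys) + (sub (x ∷_) ys + sub (λ P → P) ys)
    ≡⟨ sym (cong₂ _+_ (countSubs-∷ (λ P → p (y ∷ P)) x ys) (countSubs-∷ p x ys)) ⟩
  countSubs (λ P → p (y ∷ P)) (x ∷ ys) + countSubs p (x ∷ ys)
    ≡⟨ sym (countSubs-∷ p y (x ∷ ys)) ⟩
  countSubs p (y ∷ x ∷ ys) ∎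
  where
  sub : (List A → List A) → List A → ℕ
  sub f zs = countSubs (λ P → p (f P)) zs
  xy↦yx : sub (λ P → x ∷ y ∷ P) xs ≡ sub (λ P → y ∷ x ∷ P) ys
  xy↦yx = trans (countSubs-↭ _ (λ q' → inv (↭.prep x (↭.prep y q'))) q)
                (count-cong (sublists ys) (λ _ → inv (↭.swap x y ↭.refl)))
countSubs-↭ p inv (↭.trans q q') = trans (countSubs-↭ p inv q) (countSubs-↭ p inv q')

T⇒≡true : ∀ {b} → T b → b ≡ true
T⇒≡true {true} _ = refl

≡true⇒T : ∀ {b} → b ≡ true → T b
≡true⇒T refl = _

¬T⇒≡false : ∀ {b} → ¬ T b → b ≡ false
¬T⇒≡false {false} _ = refl
¬T⇒≡false {true}  h = ⊥-elim (h _)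

Bool-≡ : ∀ {b c : Bool} → (b ≡ true → c ≡ true) → (c ≡ true → b ≡ true) → b ≡ c
Bool-≡ {false} {false} f g = refl
Bool-≡ {false} {true}  f g = g refl
Bool-≡ {true}  {false} f g = sym (f refl)
Bool-≡ {true}  {true}  f g = refl

≡ᵇ-true : ∀ {m n} → m ≡ n → (m ≡ᵇ n) ≡ true
≡ᵇ-true {m} {n} e = T⇒≡true (≡⇒≡ᵇ m n e)

≡ᵇ-false : ∀ {m n} → m ≢ n → (m ≡ᵇ n) ≡ false
≡ᵇ-false {m} {n} ne = ¬T⇒≡false (λ t → ne (≡ᵇ⇒≡ m n t))

≡ᵇ-sound : ∀ {m n} → (m ≡ᵇ n) ≡ true → m ≡ n
≡ᵇ-sound {m} {n} e = ≡ᵇ⇒≡ m n (≡true⇒T e)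

≡ᵇ-sym : ∀ m n → (m ≡ᵇ n) ≡ (n ≡ᵇ m)
≡ᵇ-sym m n = Bool-≡ (λ e → ≡ᵇ-true (sym (≡ᵇ-sound {m} e))) (λ e → ≡ᵇ-true (sym (≡ᵇ-sound {n} e)))

<ᵇ-true : ∀ {m n} → m < n → (m <ᵇ n) ≡ true
<ᵇ-true m<n = T⇒≡true (<⇒<ᵇ m<n)

<ᵇ-false : ∀ {m n} → n ≤ m → (m <ᵇ n) ≡ false
<ᵇ-false {m} {n} n≤m = ¬T⇒≡false (λ t → <⇒≱ (<ᵇ⇒< m n t) n≤m)

≤ᵇ-true : ∀ {m n} → m ≤ n → (m ≤ᵇ n) ≡ true
≤ᵇ-true m≤n = T⇒≡true (≤⇒≤ᵇ m≤n)

≤ᵇ-false : ∀ {m n} → n < m → (m ≤ᵇ n) ≡ false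
≤ᵇ-false {m} {n} n<m = ¬T⇒≡false (λ t → <⇒≱ n<m (≤ᵇ⇒≤ m n t))

≤ᵇ-sound : ∀ {m n} → (m ≤ᵇ n) ≡ true → m ≤ n
≤ᵇ-sound {m} {n} e = ≤ᵇ⇒≤ m n (≡true⇒T e)

<⇒≤∸1 : ∀ {t b} → t < b → t ≤ b ∸ 1
<⇒≤∸1 (s≤s t≤b) = t≤b

∸1< : ∀ {b} → 1 ≤ b → b ∸ 1 < b
∸1< {suc b} _ = n<1+n b

-- bump a is the order embedding of ℕ onto ℕ ∖ {a}; unbump a inverts it off a.
bump : ℕ → ℕ → ℕ
bump a s = if s <ᵇ a then s else suc s

unbump : ℕ → ℕ → ℕ
unbump a s = if s <ᵇ a then s else pred s

bump-< : ∀ {a s} → s < a → bump a s ≡ s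
bump-< s<a rewrite <ᵇ-true s<a = refl

bump-≥ : ∀ {a s} → a ≤ s → bump a s ≡ suc s
bump-≥ a≤s rewrite <ᵇ-false a≤s = refl

bump-≢ : ∀ a s → bump a s ≢ a
bump-≢ a s with s <? a
... | yes s<a rewrite bump-< s<a = λ e → <-irrefl e s<a
... | no s≮a rewrite bump-≥ (≮⇒≥ s≮a) = λ e → <-irrefl (sym e) (s≤s (≮⇒≥ s≮a))

n≤bump : ∀ a s → s ≤ bump a s
n≤bump a s with s <? a
... | yes s<a = ≤-reflexive (sym (bump-< s<a))
... | no s≮a = ≤-trans (n≤1+n s) (≤-reflexive (sym (bump-≥ (≮⇒≥ s≮a))))

bump-mono-< : ∀ a {x y} → x < y → bump a x < bump a y
bump-mono-< a {x} {y} x<y with x <? a | y <? a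
... | yes x<a | yes y<a rewrite bump-< x<a | bump-< y<a = x<y
... | yes x<a | no y≮a  rewrite bump-< x<a | bump-≥ (≮⇒≥ y≮a) = m<n⇒m<1+n x<y
... | no x≮a  | yes y<a = ⊥-elim (x≮a (<-trans x<y y<a))
... | no x≮a  | no y≮a  rewrite bump-≥ (≮⇒≥ x≮a) | bump-≥ (≮⇒≥ y≮a) = s≤s x<y

bump-mono-≤ : ∀ a {x y} → x ≤ y → bump a x ≤ bump a y
bump-mono-≤ a x≤y with m≤n⇒m<n∨m≡n x≤y
... | inj₁ x<y  = <⇒≤ (bump-mono-< a x<y)
... | inj₂ refl = ≤-refl

bump-cancel-≤ : ∀ a {x y} → bump a x ≤ bump a y → x ≤ y
bump-cancel-≤ a {x} {y} h with x ≤? y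
... | yes x≤y = x≤y
... | no x≰y = ⊥-elim (<⇒≱ (bump-mono-< a (≰⇒> x≰y)) h)

bump-injective : ∀ a {x y} → bump a x ≡ bump a y → x ≡ y
bump-injective a e = ≤-antisym (bump-cancel-≤ a (≤-reflexive e)) (bump-cancel-≤ a (≤-reflexive (sym e)))

bump-≡ᵇ : ∀ a x y → (bump a x ≡ᵇ bump a y) ≡ (x ≡ᵇ y)
bump-≡ᵇ a x y = Bool-≡ (λ e → ≡ᵇ-true (bump-injective a (≡ᵇ-sound e)))
                       (λ e → ≡ᵇ-true (cong (bump a) (≡ᵇ-sound e)))

bump-≤ᵇ : ∀ a x y → (bump a x ≤ᵇ bump a y) ≡ (x ≤ᵇ y)
bump-≤ᵇ a x y = Bool-≡ (λ e → ≤ᵇ-true (bump-cancel-≤ a (≤ᵇ-sound e)))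
                       (λ e → ≤ᵇ-true (bump-mono-≤ a (≤ᵇ-sound e)))

bump-unbump : ∀ a s → s ≢ a → bump a (unbump a s) ≡ s
bump-unbump a s s≢a with s <? a
... | yes s<a rewrite <ᵇ-true s<a = bump-< s<a
... | no s≮a with ≤∧≢⇒< (≮⇒≥ s≮a) (s≢a ∘ sym)
... | a<s@(s≤s _) rewrite <ᵇ-false (≮⇒≥ s≮a) = bump-≥ (<⇒≤pred a<s)

unbump-positive : ∀ a s → 1 ≤ a → 1 ≤ s → s ≢ a → 1 ≤ unbump a s
unbump-positive a s 1≤a 1≤s s≢a with s <? a
... | yes s<a rewrite <ᵇ-true s<a = 1≤s
... | no s≮a rewrite <ᵇ-false (≮⇒≥ s≮a) = ≤-trans 1≤a (<⇒≤pred (≤∧≢⇒< (≮⇒≥ s≮a) (s≢a ∘ sym)))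

∧-falseˡ : ∀ {x} y → x ≡ false → x ∧ y ≡ false
∧-falseˡ y refl = refl

∧-falseʳ : ∀ x {y} → y ≡ false → x ∧ y ≡ false
∧-falseʳ x refl = ∧-zeroʳ x

∨-false : ∀ {x y} → x ≡ false → y ≡ false → x ∨ y ≡ false
∨-false refl refl = refl

allB-↭ : {A : Set} (f : A → Bool) {P Q : List A} → P ↭ Q → allB f P ≡ allB f Q
allB-↭ f ↭.refl = refl
allB-↭ f (↭.prep x q) = cong (f x ∧_) (allB-↭ f q)
allB-↭ f (↭.swap x y q) with f x | f y
... | true  | true  = allB-↭ f q
... | true  | false = refl
... | false | true  = refl
... | false | false = refl
allB-↭ f (↭.trans q q') = trans (allB-↭ f q) (allB-↭ f q')

anyB-↭ : {A : Set} (f : A → Bool) {P Q : List A} → P ↭ Q → anyB f P ≡ anyB f Q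
anyB-↭ f ↭.refl = refl
anyB-↭ f (↭.prep x q) = cong (f x ∨_) (anyB-↭ f q)
anyB-↭ f (↭.swap x y q) with f x | f y
... | true  | true  = refl
... | true  | false = refl
... | false | true  = refl
... | false | false = anyB-↭ f q
anyB-↭ f (↭.trans q q') = trans (anyB-↭ f q) (anyB-↭ f q')

allB-true : {A : Set} (f : A → Bool) (P : List A) → (∀ {y} → y ∈ P → f y ≡ true) → allB f P ≡ true
allB-true f []      h = refl
allB-true f (x ∷ P) h rewrite h (here refl) = allB-true f P (λ m → h (there m))

allB-false : {A : Set} (f : A → Bool) {P : List A} {y : A} → y ∈ P → f y ≡ false → allB f P ≡ false
allB-false f (here refl) e rewrite e = refl
allB-false f {x ∷ _} (there m) e = ∧-falseʳ (f x) (allB-false f m e)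

anyB-false : {A : Set} (f : A → Bool) (P : List A) → (∀ {y} → y ∈ P → f y ≡ false) → anyB f P ≡ false
anyB-false f []      h = refl
anyB-false f (x ∷ P) h rewrite h (here refl) = anyB-false f P (λ m → h (there m))

allB-cong : {A : Set} {f g : A → Bool} (P : List A) → (∀ y → f y ≡ g y) → allB f P ≡ allB g P
allB-cong []      h = refl
allB-cong (x ∷ P) h = cong₂ _∧_ (h x) (allB-cong P h)

anyB-cong : {A : Set} {f g : A → Bool} (P : List A) → (∀ y → f y ≡ g y) → anyB f P ≡ anyB g P
anyB-cong []      h = refl
anyB-cong (x ∷ P) h = cong₂ _∨_ (h x) (anyB-cong P h)

allB-map : {A B : Set} (f : B → Bool) (g : A → B) (P : List A) → allB f (map g P) ≡ allB (λ x → f (g x)) P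
allB-map f g []      = refl
allB-map f g (x ∷ P) = cong (f (g x) ∧_) (allB-map f g P)

anyB-map : {A B : Set} (f : B → Bool) (g : A → B) (P : List A) → anyB f (map g P) ≡ anyB (λ x → f (g x)) P
anyB-map f g []      = refl
anyB-map f g (x ∷ P) = cong (f (g x) ∨_) (anyB-map f g P)

compatible : Cell → Cell → Bool
compatible x c = not (proj₁ x ≡ᵇ proj₁ c) ∧ not (proj₂ x ≡ᵇ proj₂ c)

compatible-sym : ∀ x y → compatible x y ≡ compatible y x
compatible-sym (a , b) (c , d) rewrite ≡ᵇ-sym a c | ≡ᵇ-sym b d = refl

nonAttacking-↭ : {P Q : List Cell} → P ↭ Q → nonAttacking P ≡ nonAttacking Q
nonAttacking-↭ ↭.refl = refl
nonAttacking-↭ (↭.prep x q) = cong₂ _∧_ (allB-↭ (compatible x) q) (nonAttacking-↭ q)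
nonAttacking-↭ (↭.swap {ys = ys} x y q)
  rewrite allB-↭ (compatible x) q | allB-↭ (compatible y) q | nonAttacking-↭ q | compatible-sym x y
  with compatible y x | allB (compatible x) ys | allB (compatible y) ys
... | false | _     | _     = refl
... | true  | true  | true  = refl
... | true  | true  | false = refl
... | true  | false | true  = refl
... | true  | false | false = refl
nonAttacking-↭ (↭.trans q q') = trans (nonAttacking-↭ q) (nonAttacking-↭ q')

attacks : Cell → Cell → Bool
attacks c x = ((proj₂ x ≡ᵇ proj₂ c) ∧ (proj₁ x ≤ᵇ proj₁ c)) ∨ ((proj₁ x ≡ᵇ proj₁ c) ∧ (proj₂ x ≤ᵇ proj₂ c))

-- With these, Rℕ r λs k is definitionally countSubs (isPlacement r (cells λs) k) (cells λs).
invOn : List Cell → List Cell → ℕ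
invOn C P = count (λ x → not (attacked P x)) C

isPlacement : ℕ → List Cell → ℕ → List Cell → Bool
isPlacement r C k P = (length P ≡ᵇ r) ∧ nonAttacking P ∧ (invOn C P ≡ᵇ k)

invOn-↭ : ∀ C {P Q} → P ↭ Q → invOn C P ≡ invOn C Q
invOn-↭ C q = count-cong C (λ {x} _ → cong not (anyB-↭ (λ c → attacks c x) q))

isPlacement-↭ : ∀ r C k → PermutationInvariant (isPlacement r C k)
isPlacement-↭ r C k q rewrite ↭-length q | nonAttacking-↭ q | invOn-↭ C q = refl

∈oneTo⁻ : ∀ {t a} → t ∈ oneTo a → 1 ≤ t × t ≤ a
∈oneTo⁻ m with ∈-map⁻ suc m
... | u , u∈ , refl = s≤s z≤n , ∈-upTo⁻ u∈

∈oneTo⁺ : ∀ {t a} → 1 ≤ t → t ≤ a → t ∈ oneTo a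
∈oneTo⁺ {suc t} (s≤s z≤n) t≤a = ∈-map⁺ suc (∈-upTo⁺ t≤a)

oneTo-unique : ∀ a → Unique (oneTo a)
oneTo-unique a = Unique.map⁺ suc-injective (Unique.upTo⁺ a)

at-zero : ∀ λs → at λs 0 ≡ 0
at-zero []      = refl
at-zero (_ ∷ _) = refl

InDiagram : List ℕ → Cell → Set
InDiagram λs x = 1 ≤ proj₂ x × proj₂ x ≤ at λs (proj₁ x)

InDiagram-row-positive : ∀ {λs s t} → InDiagram λs (s , t) → 1 ≤ s
InDiagram-row-positive {λs} {zero} (1≤t , t≤) = ⊥-elim (<⇒≱ (≤-trans 1≤t t≤) (≤-reflexive (at-zero λs)))
InDiagram-row-positive {λs} {suc s} _ = s≤s z≤n

∈cellsFrom⁻ : ∀ {i λs s t} → (s , t) ∈ cellsFrom (suc i) λs →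
  Σ ℕ λ n → s ≡ suc (i + n) × 1 ≤ t × t ≤ at λs (suc n)
∈cellsFrom⁻ {i} {a ∷ λs} m with ∈-++⁻ (map (λ t → (suc i , t)) (oneTo a)) m
... | inj₁ m₁ with ∈-map⁻ (λ t → (suc i , t)) m₁
...   | _ , t∈ , refl = 0 , cong suc (sym (+-identityʳ i)) , ∈oneTo⁻ t∈
∈cellsFrom⁻ {i} {a ∷ λs} m | inj₂ m₂ with ∈cellsFrom⁻ {suc i} {λs} m₂
...   | n , refl , h = suc n , cong suc (sym (+-suc i n)) , h

∈cellsFrom⁺ : ∀ {i λs t} n → 1 ≤ t → t ≤ at λs (suc n) → (suc (i + n) , t) ∈ cellsFrom (suc i) λs
∈cellsFrom⁺ {i} {[]} n 1≤t t≤ = ⊥-elim (<⇒≱ 1≤t t≤)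
∈cellsFrom⁺ {i} {a ∷ λs} zero 1≤t t≤ rewrite +-identityʳ i =
  ∈-++⁺ˡ (∈-map⁺ (λ t → (suc i , t)) (∈oneTo⁺ 1≤t t≤))
∈cellsFrom⁺ {i} {a ∷ λs} (suc n) 1≤t t≤ rewrite +-suc i n =
  ∈-++⁺ʳ (map (λ t → (suc i , t)) (oneTo a)) (∈cellsFrom⁺ {suc i} {λs} n 1≤t t≤)

∈cells⁻ : ∀ {λs x} → x ∈ cells λs → InDiagram λs x
∈cells⁻ {λs} {s , t} m with ∈cellsFrom⁻ {0} {λs} m
... | n , refl , h = h

∈cells⁺ : ∀ {λs x} → InDiagram λs x → x ∈ cells λs
∈cells⁺ {λs} {zero , t} h = ⊥-elim (<⇒≱ (InDiagram-row-positive {λs} h) z≤n)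
∈cells⁺ {λs} {suc s , t} (1≤t , t≤) = ∈cellsFrom⁺ {0} {λs} s 1≤t t≤

cellsFrom-unique : ∀ i λs → Unique (cellsFrom (suc i) λs)
cellsFrom-unique i [] = []
cellsFrom-unique i (a ∷ λs) =
  Unique.++⁺ (Unique.map⁺ (cong proj₂) (oneTo-unique a)) (cellsFrom-unique (suc i) λs) disjoint
  where
  disjoint : ∀ {v} → ¬ (v ∈ map (λ t → (suc i , t)) (oneTo a) × v ∈ cellsFrom (suc (suc i)) λs)
  disjoint (m₁ , m₂) with ∈-map⁻ (λ t → (suc i , t)) m₁ | ∈cellsFrom⁻ {suc i} {λs} m₂
  ... | _ , _ , refl | n , e , _ = <-irrefl (suc-injective e) (s≤s (m≤m+n i n))

cells-unique : ∀ λs → Unique (cells λs)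
cells-unique = cellsFrom-unique 0

-- The corner recurrence

shortenRow : ℕ → List ℕ → List ℕ
shortenRow _             []       = []
shortenRow zero          xs       = xs
shortenRow (suc zero)    (x ∷ xs) = pred x ∷ xs
shortenRow (suc (suc n)) (x ∷ xs) = x ∷ shortenRow (suc n) xs

at-shortenRow-≡ : ∀ a F → at (shortenRow a F) a ≡ at F a ∸ 1
at-shortenRow-≡ zero          []      = refl
at-shortenRow-≡ (suc zero)    []      = refl
at-shortenRow-≡ (suc (suc a)) []      = refl
at-shortenRow-≡ zero          (x ∷ F) = refl
at-shortenRow-≡ (suc zero)    (x ∷ F) = refl
at-shortenRow-≡ (suc (suc a)) (x ∷ F) = at-shortenRow-≡ (suc a) F

at-shortenRow-≢ : ∀ a F s → s ≢ a → at (shortenRow a F) s ≡ at F s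
at-shortenRow-≢ a             []      s             s≢a = refl
at-shortenRow-≢ zero          (x ∷ F) s             s≢a = refl
at-shortenRow-≢ (suc zero)    (x ∷ F) zero          s≢a = refl
at-shortenRow-≢ (suc zero)    (x ∷ F) (suc zero)    s≢a = ⊥-elim (s≢a refl)
at-shortenRow-≢ (suc zero)    (x ∷ F) (suc (suc s)) s≢a = refl
at-shortenRow-≢ (suc (suc a)) (x ∷ F) zero          s≢a = refl
at-shortenRow-≢ (suc (suc a)) (x ∷ F) (suc zero)    s≢a = refl
at-shortenRow-≢ (suc (suc a)) (x ∷ F) (suc (suc s)) s≢a =
  at-shortenRow-≢ (suc a) F (suc s) (λ e → s≢a (cong suc e))

-- For a corner (a , b), deleting row a and shortening every row above it
-- strikes out exactly row a and column b.
strike : ℕ → List ℕ → List ℕ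
strike _             []       = []
strike zero          xs       = xs
strike (suc zero)    (x ∷ xs) = xs
strike (suc (suc n)) (x ∷ xs) = pred x ∷ strike (suc n) xs

at-strike-< : ∀ a F s → s < a → at (strike a F) s ≡ at F s ∸ 1
at-strike-< a             []      zero          _ = refl
at-strike-< a             []      (suc s)       _ = refl
at-strike-< (suc zero)    (x ∷ F) zero          _ = at-zero F
at-strike-< (suc zero)    (x ∷ F) (suc s)       (s≤s ())
at-strike-< (suc (suc a)) (x ∷ F) zero          _ = refl
at-strike-< (suc (suc a)) (x ∷ F) (suc zero)    _ = refl
at-strike-< (suc (suc a)) (x ∷ F) (suc (suc s)) (s≤s s<a) = at-strike-< (suc a) F (suc s) s<a

at-strike-≥ : ∀ a F s → 1 ≤ a → a ≤ s → at (strike a F) s ≡ at F (suc s)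
at-strike-≥ a             []      s             _ _ = refl
at-strike-≥ (suc zero)    (x ∷ F) (suc zero)    _ _ = refl
at-strike-≥ (suc zero)    (x ∷ F) (suc (suc s)) _ _ = refl
at-strike-≥ (suc (suc a)) (x ∷ F) (suc (suc s)) _ (s≤s a≤s) = at-strike-≥ (suc a) F (suc s) (s≤s z≤n) a≤s

Rpred : ℕ → List ℕ → Poly
Rpred zero    H = 0ₚ
Rpred (suc r) H = Rℕ r H

unique-⊆⇒↭ : {A : Set} {xs ys : List A} → Unique xs → Unique ys → xs ⊆ ys → ys ⊆ xs → xs ↭ ys
unique-⊆⇒↭ u v f g = ∼bag⇒↭ (unique∧set⇒bag u v (mk⇔ f g))

module Corner (F : List ℕ) (a b : ℕ) (1≤a : 1 ≤ a) (1≤b : 1 ≤ b) (Fa≡b : at F a ≡ b)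
  (above : ∀ s → 1 ≤ s → s < a → b ≤ at F s) (below : ∀ s → a < s → at F s < b) where

  c : Cell
  c = (a , b)

  F⁻ H : List ℕ
  F⁻ = shortenRow a F
  H  = strike a F

  C D E : List Cell
  C = cells F
  D = cells F⁻
  E = cells H

  -- The cells of H, placed back into F around row a and column b.
  embed : Cell → Cell
  embed (s , t) = (bump a s , bump b t)

  embed-injective : ∀ {x y} → embed x ≡ embed y → x ≡ y
  embed-injective e = cong₂ _,_ (bump-injective a (cong proj₁ e)) (bump-injective b (cong proj₂ e))

  inCross : Cell → Bool
  inCross x = (proj₁ x ≡ᵇ a) ∨ (proj₂ x ≡ᵇ b)

  cross : List Cell
  cross = filterᵇ inCross D

  F⁻a : at F⁻ a ≡ b ∸ 1
  F⁻a = trans (at-shortenRow-≡ a F) (cong (_∸ 1) Fa≡b)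

  F⁻≢ : ∀ s → s ≢ a → at F⁻ s ≡ at F s
  F⁻≢ = at-shortenRow-≢ a F

  F⁻≤F : ∀ s → at F⁻ s ≤ at F s
  F⁻≤F s with s ≟ a
  ... | yes refl = ≤-trans (≤-reflexive (at-shortenRow-≡ a F)) (m∸n≤m (at F a) 1)
  ... | no s≢a  = ≤-reflexive (F⁻≢ s s≢a)

  c∈C : c ∈ C
  c∈C = ∈cells⁺ {F} (1≤b , ≤-reflexive (sym Fa≡b))

  D-row-a : ∀ {t} → (a , t) ∈ D → t < b
  D-row-a m = ≤-<-trans (≤-trans (proj₂ (∈cells⁻ {F⁻} m)) (≤-reflexive F⁻a)) (∸1< 1≤b)

  D-below : ∀ {s t} → (s , t) ∈ D → a < s → t < b
  D-below {s} m a<s = ≤-<-trans (≤-trans (proj₂ (∈cells⁻ {F⁻} m)) (F⁻≤F s)) (below s a<s)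

  c∉D : ¬ (c ∈ D)
  c∉D m = <-irrefl refl (D-row-a m)

  ∈C⇒≡c⊎∈D : ∀ {x} → x ∈ C → x ≡ c ⊎ x ∈ D
  ∈C⇒≡c⊎∈D {s , t} m with ∈cells⁻ {F} m
  ... | 1≤t , t≤ with s ≟ a
  ... | no s≢a = inj₂ (∈cells⁺ {F⁻} (1≤t , subst (t ≤_) (sym (F⁻≢ s s≢a)) t≤))
  ... | yes refl with t ≟ b
  ...   | yes refl = inj₁ refl
  ...   | no t≢b   = inj₂ (∈cells⁺ {F⁻} (1≤t , subst (t ≤_) (sym F⁻a) (<⇒≤∸1 (≤∧≢⇒< (subst (t ≤_) Fa≡b t≤) t≢b))))

  D⊆C : D ⊆ C
  D⊆C {s , t} m with ∈cells⁻ {F⁻} m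
  ... | 1≤t , t≤ = ∈cells⁺ {F} (1≤t , ≤-trans t≤ (F⁻≤F s))

  C↭c∷D : C ↭ c ∷ D
  C↭c∷D = unique-⊆⇒↭ (cells-unique F) (All.tabulate (λ m e → c∉D (subst (_∈ D) (sym e) m)) ∷ cells-unique F⁻)
               (λ m → [_,_]′ here there (∈C⇒≡c⊎∈D m))
               (λ { (here refl) → c∈C ; (there m) → D⊆C m })

  embed-∈D : ∀ {y} → y ∈ E → embed y ∈ D
  embed-∈D {s , t} m with ∈cells⁻ {H} m
  ... | 1≤t , t≤ = ∈cells⁺ {F⁻} (≤-trans 1≤t (n≤bump b t) , subst (bump b t ≤_) (sym (F⁻≢ (bump a s) (bump-≢ a s))) fits)
    where
    t≤-above : s < a → t ≤ at F s ∸ 1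
    t≤-above s<a = subst (t ≤_) (at-strike-< a F s s<a) t≤
    t≤-below : a ≤ s → t ≤ at F (suc s)
    t≤-below a≤s = subst (t ≤_) (at-strike-≥ a F s 1≤a a≤s) t≤
    fits : bump b t ≤ at F (bump a s)
    fits with s <? a
    ... | yes s<a rewrite bump-< s<a with t <? b
    ...   | yes t<b rewrite bump-< t<b = ≤-trans (t≤-above s<a) (m∸n≤m _ 1)
    ...   | no t≮b rewrite bump-≥ (≮⇒≥ t≮b) =
            ≤-trans (s≤s (t≤-above s<a)) (≤-reflexive (m+[n∸m]≡n (≤-trans 1≤b (above s (InDiagram-row-positive {H} (1≤t , t≤)) s<a))))
    fits | no s≮a with ≮⇒≥ s≮a
    ... | a≤s rewrite bump-≥ a≤s = ≤-trans (≤-reflexive (bump-< (≤-<-trans (t≤-below a≤s) (below (suc s) (s≤s a≤s))))) (t≤-below a≤s)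

  inCross-embed : ∀ y → inCross (embed y) ≡ false
  inCross-embed (s , t) = ∨-false (≡ᵇ-false (bump-≢ a s)) (≡ᵇ-false (bump-≢ b t))

  ∈D⇒cross⊎embedded : ∀ {x} → x ∈ D → inCross x ≡ true ⊎ Σ Cell (λ y → y ∈ E × x ≡ embed y)
  ∈D⇒cross⊎embedded {s , t} m with s ≟ a | t ≟ b
  ... | yes s≡a | _       = inj₁ (cong (_∨ (t ≡ᵇ b)) (≡ᵇ-true s≡a))
  ... | no _    | yes t≡b = inj₁ (trans (cong ((s ≡ᵇ a) ∨_) (≡ᵇ-true t≡b)) (∨-zeroʳ (s ≡ᵇ a)))
  ... | no s≢a  | no t≢b with ∈cells⁻ {F⁻} m
  ... | 1≤t , t≤ = inj₂ ((unbump a s , unbump b t) ,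
                         ∈cells⁺ {H} (unbump-positive b t 1≤b 1≤t t≢b , fits) ,
                         sym (cong₂ _,_ (bump-unbump a s s≢a) (bump-unbump b t t≢b)))
    where
    t≤Fs : t ≤ at F s
    t≤Fs = subst (t ≤_) (F⁻≢ s s≢a) t≤
    fits : unbump b t ≤ at H (unbump a s)
    fits with s <? a
    ... | yes s<a rewrite <ᵇ-true s<a | at-strike-< a F s s<a with t <? b
    ...   | yes t<b rewrite <ᵇ-true t<b = ≤-trans (<⇒≤∸1 t<b) (∸-monoˡ-≤ 1 (above s (InDiagram-row-positive {F⁻} (1≤t , t≤)) s<a))
    ...   | no t≮b rewrite <ᵇ-false (≮⇒≥ t≮b) = ∸-monoˡ-≤ 1 t≤Fs
    fits | no s≮a with ≤∧≢⇒< (≮⇒≥ s≮a) (s≢a ∘ sym)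
    ... | a<s@(s≤s _) rewrite <ᵇ-false (≮⇒≥ s≮a) | <ᵇ-true (D-below m a<s) | at-strike-≥ a F (pred s) 1≤a (<⇒≤pred a<s) = t≤Fs

  D↭cross++embedE : D ↭ cross ++ map embed E
  D↭cross++embedE = unique-⊆⇒↭ (cells-unique F⁻)
    (Unique.++⁺ (Unique.filter⁺ (T? ∘ inCross) (cells-unique F⁻)) (Unique.map⁺ embed-injective (cells-unique H)) disjoint)
    to from
    where
    disjoint : ∀ {v} → ¬ (v ∈ cross × v ∈ map embed E)
    disjoint (m₁ , m₂) with ∈-filter⁻ (T? ∘ inCross) {xs = D} m₁ | ∈-map⁻ embed m₂
    ... | _ , t | y , _ , refl with trans (sym (T⇒≡true t)) (inCross-embed y)
    ... | ()
    to : D ⊆ cross ++ map embed E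
    to m with ∈D⇒cross⊎embedded m
    ... | inj₁ e = ∈-++⁺ˡ (∈-filter⁺ (T? ∘ inCross) m (≡true⇒T e))
    ... | inj₂ (y , y∈ , refl) = ∈-++⁺ʳ cross (∈-map⁺ embed y∈)
    from : cross ++ map embed E ⊆ D
    from m with ∈-++⁻ cross m
    ... | inj₁ m₁ = proj₁ (∈-filter⁻ (T? ∘ inCross) {xs = D} m₁)
    ... | inj₂ m₂ with ∈-map⁻ embed m₂
    ... | y , y∈ , refl = embed-∈D y∈

  attacks-D-c : ∀ {x} → x ∈ D → attacks x c ≡ false
  attacks-D-c {s , t} m with <-cmp s a
  ... | tri< s<a _ _ = ∨-false (∧-falseʳ (b ≡ᵇ t) (≤ᵇ-false s<a)) (∧-falseˡ (b ≤ᵇ t) (≡ᵇ-false (λ e → <-irrefl (sym e) s<a)))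
  ... | tri≈ _ refl _ = ∨-false (∧-falseˡ _ (≡ᵇ-false (λ e → <-irrefl (sym e) (D-row-a m)))) (∧-falseʳ _ (≤ᵇ-false (D-row-a m)))
  ... | tri> _ _ a<s = ∨-false (∧-falseˡ _ (≡ᵇ-false (λ e → <-irrefl (sym e) (D-below m a<s)))) (∧-falseˡ _ (≡ᵇ-false (λ e → <-irrefl e a<s)))

  attacks-c-cross : ∀ {x} → x ∈ D → inCross x ≡ true → attacks c x ≡ true
  attacks-c-cross {s , t} m e with s ≟ a
  ... | yes refl rewrite ≡ᵇ-true {a} refl | ≤ᵇ-true (<⇒≤ (D-row-a m)) = ∨-zeroʳ _
  ... | no s≢a with t ≟ b
  ...   | no t≢b rewrite ≡ᵇ-false s≢a | ≡ᵇ-false t≢b = e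
  ...   | yes refl rewrite ≡ᵇ-true {b} refl with s ≤? a
  ...     | yes s≤a rewrite ≤ᵇ-true s≤a = refl
  ...     | no s≰a = ⊥-elim (<-irrefl refl (D-below m (≰⇒> s≰a)))

  cross-incompatible : ∀ {x} → inCross x ≡ true → compatible c x ≡ false
  cross-incompatible {s , t} e with s ≟ a
  ... | yes refl rewrite ≡ᵇ-true {a} refl = refl
  ... | no s≢a with t ≟ b
  ...   | yes refl rewrite ≡ᵇ-true {b} refl = ∧-zeroʳ _
  ...   | no t≢b rewrite ≡ᵇ-false s≢a | ≡ᵇ-false t≢b with e
  ...     | ()

  compatible-c-embed : ∀ y → compatible c (embed y) ≡ true
  compatible-c-embed (s , t) rewrite ≡ᵇ-false (bump-≢ a s ∘ sym) | ≡ᵇ-false (bump-≢ b t ∘ sym) = refl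

  compatible-c-map-embed : ∀ P {y} → y ∈ map embed P → compatible c y ≡ true
  compatible-c-map-embed P m with ∈-map⁻ embed m
  ... | y , _ , refl = compatible-c-embed y

  compatible-embed : ∀ x y → compatible (embed x) (embed y) ≡ compatible x y
  compatible-embed (s , t) (s' , t') rewrite bump-≡ᵇ a s s' | bump-≡ᵇ b t t' = refl

  attacks-embed : ∀ u y → attacks (embed u) (embed y) ≡ attacks u y
  attacks-embed (s , t) (s' , t') rewrite bump-≡ᵇ a s' s | bump-≡ᵇ b t' t | bump-≤ᵇ a s' s | bump-≤ᵇ b t' t = refl

  attacks-c-embed : ∀ y → attacks c (embed y) ≡ false
  attacks-c-embed (s , t) = ∨-false (∧-falseˡ _ (≡ᵇ-false (bump-≢ b t))) (∧-falseˡ _ (≡ᵇ-false (bump-≢ a s)))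

  attacks-c-c : attacks c c ≡ true
  attacks-c-c rewrite ≡ᵇ-true {b} refl | ≤ᵇ-true (≤-refl {a}) = refl

  nonAttacking-embed : ∀ P → nonAttacking (map embed P) ≡ nonAttacking P
  nonAttacking-embed []      = refl
  nonAttacking-embed (x ∷ P) =
    cong₂ _∧_ (trans (allB-map (compatible (embed x)) embed P) (allB-cong P (compatible-embed x)))
              (nonAttacking-embed P)

  -- Placements avoiding c leave c unattacked, since c is the last cell of its row and column.
  invOn-C-avoiding-c : ∀ P → P ⊆ D → invOn C P ≡ suc (invOn D P)
  invOn-C-avoiding-c P P⊆D = begin
    count free C
      ≡⟨ count-↭ free C↭c∷D ⟩
    ind (not (anyB (λ u → attacks u c) P)) + count free D
      ≡⟨ cong (λ z → ind (not z) + count free D) (anyB-false (λ u → attacks u c) P (λ m → attacks-D-c (P⊆D m))) ⟩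
    suc (count free D) ∎
    where
    free : Cell → Bool
    free x = not (attacked P x)

  invOn-C-through-c : ∀ P → invOn C (c ∷ map embed P) ≡ invOn E P
  invOn-C-through-c P = begin
    count free C
      ≡⟨ count-↭ free (↭.trans C↭c∷D (↭.prep c D↭cross++embedE)) ⟩
    ind (free c) + count free (cross ++ map embed E)
      ≡⟨ cong (λ z → ind (not (z ∨ anyB (λ u → attacks u c) (map embed P))) + count free (cross ++ map embed E)) attacks-c-c ⟩
    count free (cross ++ map embed E)
      ≡⟨ count-++ free cross (map embed E) ⟩
    count free cross + count free (map embed E)
      ≡⟨ cong₂ _+_ cross-attacked (count-map free embed E) ⟩
    count (λ y → free (embed y)) E
      ≡⟨ count-cong E (λ {y} _ → free-embed y) ⟩
    invOn E P ∎
    where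
    free : Cell → Bool
    free x = not (attacked (c ∷ map embed P) x)
    cross-attacked : count free cross ≡ 0
    cross-attacked = trans
      (count-cong cross (λ {x} m → let (x∈D , t) = ∈-filter⁻ (T? ∘ inCross) {xs = D} m in
        cong (λ z → not (z ∨ anyB (λ u → attacks u x) (map embed P))) (attacks-c-cross x∈D (T⇒≡true t))))
      (count-false cross (λ _ → refl))
    free-embed : ∀ y → free (embed y) ≡ not (attacked P y)
    free-embed y rewrite attacks-c-embed y =
      cong not (trans (anyB-map (λ u → attacks u (embed y)) embed P) (anyB-cong P (λ u → attacks-embed u y)))

  placements-avoiding-c : ∀ r k → countSubs (isPlacement r C k) D ≡ shift 1 (Rℕ r F⁻) k
  placements-avoiding-c r zero = trans
    (countSubs-cong D (λ P P⊆D → ∧-falseʳ (length P ≡ᵇ r) (∧-falseʳ (nonAttacking P) (cong (_≡ᵇ 0) (invOn-C-avoiding-c P P⊆D)))))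
    (countSubs-false {p = λ _ → false} D (λ _ → refl))
  placements-avoiding-c r (suc k) =
    countSubs-cong D (λ P P⊆D → cong (λ z → (length P ≡ᵇ r) ∧ nonAttacking P ∧ (z ≡ᵇ suc k)) (invOn-C-avoiding-c P P⊆D))

  -- A placement through c may only use cells off its row and column, i.e. embedded cells of H.
  placements-through-c : ∀ r k → countSubs (λ P → isPlacement r C k (c ∷ P)) D ≡ Rpred r H k
  placements-through-c r k = begin
    countSubs through D
      ≡⟨ countSubs-↭ through (λ q → isPlacement-↭ r C k (↭.prep c q)) D↭cross++embedE ⟩
    countSubs through (cross ++ map embed E)
      ≡⟨ countSubs-avoiding through cross (map embed E) meets-cross ⟩
    countSubs through (map embed E)
      ≡⟨ countSubs-map through embed E ⟩
    countSubs (λ P → through (map embed P)) E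
      ≡⟨ embedded r ⟩
    Rpred r H k ∎
    where
    through : List Cell → Bool
    through P = isPlacement r C k (c ∷ P)
    meets-cross : ∀ P {y} → y ∈ cross → y ∈ P → through P ≡ false
    meets-cross P y∈cross y∈P =
      ∧-falseʳ (suc (length P) ≡ᵇ r) (∧-falseˡ (invOn C (c ∷ P) ≡ᵇ k) (∧-falseˡ (nonAttacking P)
        (allB-false (compatible c) y∈P (cross-incompatible (T⇒≡true (proj₂ (∈-filter⁻ (T? ∘ inCross) {xs = D} y∈cross)))))))
    embedded : ∀ r → countSubs (λ P → isPlacement r C k (c ∷ map embed P)) E ≡ Rpred r H k
    embedded zero    = countSubs-false E (λ P → refl)
    embedded (suc r) = countSubs-cong E (λ P _ → placement-embed P)
      where
      placement-embed : ∀ P → isPlacement (suc r) C k (c ∷ map embed P) ≡ isPlacement r E k P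
      placement-embed P rewrite length-map embed P | allB-true (compatible c) (map embed P) (compatible-c-map-embed P)
                              | nonAttacking-embed P | invOn-C-through-c P = refl

  corner-recurrence : ∀ r → Rℕ r F ≈ₚ (shift 1 (Rℕ r F⁻) ⊕ Rpred r H)
  corner-recurrence r k = begin
    countSubs (isPlacement r C k) C
      ≡⟨ countSubs-↭ (isPlacement r C k) (isPlacement-↭ r C k) C↭c∷D ⟩
    countSubs (isPlacement r C k) (c ∷ D)
      ≡⟨ countSubs-∷ (isPlacement r C k) c D ⟩
    countSubs (λ P → isPlacement r C k (c ∷ P)) D + countSubs (isPlacement r C k) D
      ≡⟨ cong₂ _+_ (placements-through-c r k) (placements-avoiding-c r k) ⟩
    Rpred r H k + shift 1 (Rℕ r F⁻) k
      ≡⟨ +-comm (Rpred r H k) _ ⟩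
    shift 1 (Rℕ r F⁻) k + Rpred r H k ∎

oneTo-suc : ∀ n → oneTo (suc n) ≡ 1 ∷ map suc (oneTo n)
oneTo-suc n = begin
  map suc (upTo (suc n))                   ≡⟨ map-upTo suc (suc n) ⟩
  1 ∷ applyUpTo (λ x → suc (suc x)) n      ≡⟨ cong (1 ∷_) (sym (map-upTo (λ x → suc (suc x)) n)) ⟩
  1 ∷ map (λ x → suc (suc x)) (upTo n)     ≡⟨ cong (1 ∷_) (map-∘ (upTo n)) ⟩
  1 ∷ map suc (map suc (upTo n))           ∎

count-oneTo-suc : ∀ (p : ℕ → Bool) n → count p (oneTo (suc n)) ≡ ind (p 1) + count (p ∘ suc) (oneTo n)
count-oneTo-suc p n = trans (cong (count p) (oneTo-suc n)) (cong (ind (p 1) +_) (count-map p suc (oneTo n)))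

count-oneTo-cong : ∀ {p q : ℕ → Bool} n → (∀ s → 1 ≤ s → s ≤ n → p s ≡ q s) → count p (oneTo n) ≡ count q (oneTo n)
count-oneTo-cong n h = count-cong (oneTo n) (λ m → let (1≤s , s≤n) = ∈oneTo⁻ m in h _ 1≤s s≤n)

count-oneTo-one-more : ∀ {p q : ℕ → Bool} n a → 1 ≤ a → a ≤ n → p a ≡ true → q a ≡ false →
  (∀ s → 1 ≤ s → s ≤ n → s ≢ a → p s ≡ q s) → count p (oneTo n) ≡ suc (count q (oneTo n))
count-oneTo-one-more {p} {q} (suc n) (suc zero) _ _ pa qa h
  rewrite count-oneTo-suc p n | count-oneTo-suc q n | pa | qa =
  cong suc (count-oneTo-cong n (λ s 1≤s s≤n → h (suc s) (s≤s z≤n) (s≤s s≤n) (λ e → <-irrefl (sym (suc-injective e)) 1≤s)))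
count-oneTo-one-more {p} {q} (suc n) (suc (suc a)) _ (s≤s a≤n) pa qa h
  rewrite count-oneTo-suc p n | count-oneTo-suc q n | h 1 (s≤s z≤n) (s≤s z≤n) (λ ()) =
  trans (cong (ind (q 1) +_) (count-oneTo-one-more {p ∘ suc} {q ∘ suc} n (suc a) (s≤s z≤n) a≤n pa qa
                                (λ s _ s≤n s≢ → h (suc s) (s≤s z≤n) (s≤s s≤n) (s≢ ∘ suc-injective))))
        (+-suc (ind (q 1)) _)

-- Deleting the point a from 1, …, n + 1 and renumbering the points above it.
count-oneTo-skip : ∀ (P : ℕ → Bool) n a → 1 ≤ a →
  count P (oneTo (suc n)) ≡ count (λ s → if s <ᵇ a then P s else P (suc s)) (oneTo n) + ind (if a ≤ᵇ suc n then P a else P (suc n))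
count-oneTo-skip P n (suc zero) _ = trans (count-oneTo-suc P n) (trans (+-comm (ind (P 1)) _)
  (cong (_+ ind (P 1)) (sym (count-oneTo-cong n (λ s 1≤s _ → cong (λ b → if b then P s else P (suc s)) (<ᵇ-false 1≤s))))))
count-oneTo-skip P zero (suc (suc a)) _ = +-identityʳ _
count-oneTo-skip P (suc n) (suc (suc a)) _ = begin
  count P (oneTo (suc (suc n)))
    ≡⟨ count-oneTo-suc P (suc n) ⟩
  ind (P 1) + count (P ∘ suc) (oneTo (suc n))
    ≡⟨ cong (ind (P 1) +_) (count-oneTo-skip (P ∘ suc) n (suc a) (s≤s z≤n)) ⟩
  ind (P 1) + (count skipped′ (oneTo n) + last)
    ≡⟨ sym (+-assoc (ind (P 1)) _ _) ⟩
  ind (P 1) + count skipped′ (oneTo n) + last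
    ≡⟨ cong (_+ last) (sym (count-oneTo-suc skipped n)) ⟩
  count skipped (oneTo (suc n)) + last ∎
  where
  skipped skipped′ : ℕ → Bool
  skipped  s = if s <ᵇ suc (suc a) then P s else P (suc s)
  skipped′ s = if s <ᵇ suc a then P (suc s) else P (suc (suc s))
  last : ℕ
  last = ind (if suc a ≤ᵇ suc n then P (suc (suc a)) else P (suc (suc n)))

IsFerrers-antitone : ∀ {F} → IsFerrers F → ∀ {s s'} → 1 ≤ s → s ≤ s' → at F s' ≤ at F s
IsFerrers-antitone {F} fer {s} {s'} 1≤s s≤s' with m≤n⇒m<n∨m≡n s≤s'
... | inj₂ refl = ≤-refl
... | inj₁ s<s' with s'
... | suc s'' = ≤-trans (fer s'' (≤-trans 1≤s (≤-pred s<s'))) (IsFerrers-antitone {F} fer 1≤s (≤-pred s<s'))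

inF-true : ∀ {λs s t} → 1 ≤ t → t ≤ at λs s → inF λs (s , t) ≡ true
inF-true 1≤t t≤ rewrite ≤ᵇ-true 1≤t | ≤ᵇ-true t≤ = refl

inF-false : ∀ {λs s t} → at λs s < t → inF λs (s , t) ≡ false
inF-false {t = t} h = ∧-falseʳ (1 ≤ᵇ t) (≤ᵇ-false h)

inF-sound : ∀ {λs s t} → inF λs (s , t) ≡ true → 1 ≤ t × t ≤ at λs s
inF-sound {λs} {s} {t} e with 1 ≤ᵇ t in e₁ | t ≤ᵇ at λs s in e₂
... | true | true = ≤ᵇ-sound e₁ , ≤ᵇ-sound e₂

-- The last term records the cell of diagonal i + 1 that does not survive in strike a F.
diag-strike : ∀ F a i → 1 ≤ a →
  diag F (suc i) ≡ diag (strike a F) i + ind (if a ≤ᵇ suc i then inF F (a , suc (suc i) ∸ a) else inF F (suc i , 1))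
diag-strike F a i 1≤a =
  trans (count-oneTo-skip onDiagonal i a 1≤a)
        (cong₂ _+_ (count-oneTo-cong i renumber) (cong (λ t → ind (if a ≤ᵇ suc i then inF F (a , suc (suc i) ∸ a) else inF F (suc i , t))) (m+n∸n≡m 1 (suc i))))
  where
  onDiagonal : ℕ → Bool
  onDiagonal s = inF F (s , suc (suc i) ∸ s)
  renumber : ∀ s → 1 ≤ s → s ≤ i → (if s <ᵇ a then onDiagonal s else onDiagonal (suc s)) ≡ inF (strike a F) (s , suc i ∸ s)
  renumber s 1≤s s≤i with s <? a
  ... | yes s<a rewrite <ᵇ-true s<a | at-strike-< a F s s<a | +-∸-assoc 1 (≤-trans s≤i (n≤1+n i)) =
        shift-down (suc i ∸ s) (at F s) (≤-trans (s≤s z≤n) (≤-reflexive (sym (+-∸-assoc 1 s≤i))))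
    where
    shift-down : ∀ t x → 1 ≤ t → ((1 ≤ᵇ suc t) ∧ (suc t ≤ᵇ x)) ≡ ((1 ≤ᵇ t) ∧ (t ≤ᵇ x ∸ 1))
    shift-down (suc t) zero    _ = refl
    shift-down (suc t) (suc x) _ = refl
  ... | no s≮a rewrite <ᵇ-false (≮⇒≥ s≮a) | at-strike-≥ a F s 1≤a (≮⇒≥ s≮a) = refl

record Truncation (ℓ : ℕ) (F G : List ℕ) : Set where
  field
    ferrers : IsFerrers G
    agrees  : ∀ i → i < ℓ → diag G i ≡ diag F i
    empty   : ∀ i → ℓ ≤ i → diag G i ≡ 0

-- If F has diagonals (d₁, …, d_ℓ), then G has diagonals (d₂ - 1, …, d_{ℓ-1} - 1, j - 1).
record Stripped (ℓ j : ℕ) (F G : List ℕ) : Set where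
  field
    ferrers : IsFerrers G
    lowered : ∀ i → suc i < ℓ → diag G i ≡ diag F (suc i) ∸ 1
    last    : ∀ i → suc i ≡ ℓ → diag G i ≡ j ∸ 1
    empty   : ∀ i → ℓ ≤ i → diag G i ≡ 0

module CornerOnDiagonal (F : List ℕ) (fer : IsFerrers F) (ℓ a b : ℕ) (1≤a : 1 ≤ a) (1≤b : 1 ≤ b)
  (a+b≡1+ℓ : a + b ≡ suc ℓ) (Fa≡b : at F a ≡ b) (below : ∀ s → a < s → at F s < b)
  (beyond : ∀ j → ℓ < j → diag F j ≡ 0) where

  above : ∀ s → 1 ≤ s → s < a → b ≤ at F s
  above s 1≤s s<a = subst (_≤ at F s) Fa≡b (IsFerrers-antitone {F} fer 1≤s (<⇒≤ s<a))

  open Corner F a b 1≤a 1≤b Fa≡b above below public using (F⁻; H; F⁻a; F⁻≢; corner-recurrence)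

  1+ℓ∸a≡b : suc ℓ ∸ a ≡ b
  1+ℓ∸a≡b = trans (cong (_∸ a) (sym a+b≡1+ℓ)) (m+n∸m≡n a b)

  a≤ℓ : a ≤ ℓ
  a≤ℓ = ≤-pred (≤-trans (≤-trans (≤-reflexive (+-comm 1 a)) (+-monoʳ-≤ a 1≤b)) (≤-reflexive a+b≡1+ℓ))

  diag-F⁻-≢ : ∀ i → i ≢ ℓ → diag F⁻ i ≡ diag F i
  diag-F⁻-≢ i i≢ℓ = count-oneTo-cong i same
    where
    same : ∀ s → 1 ≤ s → s ≤ i → inF F⁻ (s , suc i ∸ s) ≡ inF F (s , suc i ∸ s)
    same s 1≤s s≤i with s ≟ a
    ... | no s≢a rewrite F⁻≢ s s≢a = refl
    ... | yes refl rewrite F⁻a | Fa≡b = cong ((1 ≤ᵇ suc i ∸ a) ∧_) (Bool-≡ (≤ᵇ-true ∘ weaken) (≤ᵇ-true ∘ strengthen))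
      where
      t : ℕ
      t = suc i ∸ a
      t≢b : t ≢ b
      t≢b e = i≢ℓ (suc-injective (trans (sym (m∸n+n≡m (≤-trans s≤i (n≤1+n i)))) (trans (cong (_+ a) e) (trans (+-comm b a) a+b≡1+ℓ))))
      weaken : (t ≤ᵇ b ∸ 1) ≡ true → t ≤ b
      weaken e = ≤-trans (≤ᵇ-sound {t} e) (m∸n≤m b 1)
      strengthen : (t ≤ᵇ b) ≡ true → t ≤ b ∸ 1
      strengthen e = <⇒≤∸1 (≤∧≢⇒< (≤ᵇ-sound {t} e) t≢b)

  diag-F⁻-ℓ : diag F ℓ ≡ suc (diag F⁻ ℓ)
  diag-F⁻-ℓ = count-oneTo-one-more ℓ a 1≤a a≤ℓ corner-in-F corner-not-in-F⁻ same
    where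
    corner-in-F : inF F (a , suc ℓ ∸ a) ≡ true
    corner-in-F rewrite 1+ℓ∸a≡b = inF-true {F} 1≤b (≤-reflexive (sym Fa≡b))
    corner-not-in-F⁻ : inF F⁻ (a , suc ℓ ∸ a) ≡ false
    corner-not-in-F⁻ rewrite 1+ℓ∸a≡b = inF-false {F⁻} (subst (_< b) (sym F⁻a) (∸1< 1≤b))
    same : ∀ s → 1 ≤ s → s ≤ ℓ → s ≢ a → inF F (s , suc ℓ ∸ s) ≡ inF F⁻ (s , suc ℓ ∸ s)
    same s _ _ s≢a rewrite F⁻≢ s s≢a = refl

  -- The cell of diagonal i + 1 that strike a F loses (see diag-strike) is really a cell of F.
  lost-cell-in-F : ∀ i → suc i ≤ ℓ →
    (if a ≤ᵇ suc i then inF F (a , suc (suc i) ∸ a) else inF F (suc i , 1)) ≡ true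
  lost-cell-in-F i 1+i≤ℓ with a ≤? suc i
  ... | yes a≤1+i rewrite ≤ᵇ-true a≤1+i =
        inF-true {F} (≤-trans (s≤s z≤n) (≤-reflexive (sym (+-∸-assoc 1 a≤1+i))))
                     (≤-trans (∸-monoˡ-≤ a (s≤s 1+i≤ℓ)) (≤-reflexive (trans 1+ℓ∸a≡b (sym Fa≡b))))
  ... | no a≰1+i rewrite ≤ᵇ-false (≰⇒> a≰1+i) =
        inF-true {F} (s≤s z≤n) (≤-trans 1≤b (above (suc i) (s≤s z≤n) (≰⇒> a≰1+i)))

  diag-H-below : ∀ i → suc i ≤ ℓ → diag H i ≡ diag F (suc i) ∸ 1
  diag-H-below i 1+i≤ℓ rewrite diag-strike F a i 1≤a | lost-cell-in-F i 1+i≤ℓ = sym (m+n∸n≡m _ 1)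

  diag-H-beyond : ∀ i → ℓ ≤ i → diag H i ≡ 0
  diag-H-beyond i ℓ≤i = m+n≡0⇒m≡0 _ (trans (sym (diag-strike F a i 1≤a)) (beyond (suc i) (s≤s ℓ≤i)))

  F⁻-Ferrers : IsFerrers F⁻
  F⁻-Ferrers s 1≤s with suc s ≟ a | s ≟ a
  ... | yes refl | _ rewrite F⁻≢ s (λ e → <-irrefl e (n<1+n s)) | F⁻a =
        ≤-trans (m∸n≤m b 1) (above s 1≤s (n<1+n s))
  ... | no _ | yes refl rewrite F⁻≢ (suc a) (λ e → <-irrefl (sym e) (n<1+n a)) | F⁻a =
        <⇒≤∸1 (below (suc a) (n<1+n a))
  ... | no 1+s≢a | no s≢a rewrite F⁻≢ s s≢a | F⁻≢ (suc s) 1+s≢a = fer s 1≤s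

  H-Ferrers : IsFerrers H
  H-Ferrers s 1≤s with suc s <? a
  ... | yes 1+s<a rewrite at-strike-< a F (suc s) 1+s<a | at-strike-< a F s (<-trans (n<1+n s) 1+s<a) =
        ∸-monoˡ-≤ 1 (fer s 1≤s)
  ... | no 1+s≮a with s <? a
  ...   | yes s<a rewrite at-strike-≥ a F (suc s) 1≤a (≮⇒≥ 1+s≮a) | at-strike-< a F s s<a =
          <⇒≤∸1 (<-≤-trans (below (suc (suc s)) (s≤s (≮⇒≥ 1+s≮a))) (above s 1≤s s<a))
  ...   | no s≮a rewrite at-strike-≥ a F (suc s) 1≤a (≮⇒≥ 1+s≮a) | at-strike-≥ a F s 1≤a (≮⇒≥ s≮a) =
          fer (suc s) (s≤s z≤n)

  truncation-F⁻ : ∀ {G} → Truncation ℓ F⁻ G → Truncation ℓ F G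
  truncation-F⁻ tr = record
    { ferrers = Truncation.ferrers tr
    ; agrees  = λ i i<ℓ → trans (Truncation.agrees tr i i<ℓ) (diag-F⁻-≢ i (λ e → <-irrefl e i<ℓ))
    ; empty   = Truncation.empty tr
    }

  stripped-F⁻ : ∀ {j G} → Stripped ℓ j F⁻ G → Stripped ℓ j F G
  stripped-F⁻ S = record
    { ferrers = Stripped.ferrers S
    ; lowered = λ i 1+i<ℓ → trans (Stripped.lowered S i 1+i<ℓ) (cong (_∸ 1) (diag-F⁻-≢ (suc i) (λ e → <-irrefl e 1+i<ℓ)))
    ; last    = Stripped.last S
    ; empty   = Stripped.empty S
    }

  H-stripped : ∀ {m} → diag F ℓ ≡ suc m → Stripped ℓ (suc m) F H
  H-stripped dℓ≡1+m = record
    { ferrers = H-Ferrers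
    ; lowered = λ i 1+i<ℓ → diag-H-below i (<⇒≤ 1+i<ℓ)
    ; last    = λ i 1+i≡ℓ → trans (diag-H-below i (≤-reflexive 1+i≡ℓ)) (cong (_∸ 1) (trans (cong (diag F) 1+i≡ℓ) dℓ≡1+m))
    ; empty   = diag-H-beyond
    }

lastDiagonalCorner : ∀ F ℓ m → IsFerrers F → (∀ j → ℓ < j → diag F j ≡ 0) → diag F ℓ ≡ suc m →
  Σ ℕ λ a → Σ ℕ λ b → (1 ≤ a) × (1 ≤ b) × (a + b ≡ suc ℓ) × (at F a ≡ b) × (∀ s → a < s → at F s < b)
lastDiagonalCorner F ℓ m fer beyond dℓ
  with count-witness (oneTo ℓ) (subst (1 ≤_) (sym dℓ) (s≤s z≤n))
... | a , a∈ , onDiagonal with ∈oneTo⁻ a∈ | inF-sound {F} onDiagonal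
... | 1≤a , a≤ℓ | 1≤b , b≤Fa = a , b , 1≤a , 1≤b , a+b≡1+ℓ , Fa≡b , below
  where
  b : ℕ
  b = suc ℓ ∸ a
  a≤1+ℓ : a ≤ suc ℓ
  a≤1+ℓ = ≤-trans a≤ℓ (n≤1+n ℓ)
  a+b≡1+ℓ : a + b ≡ suc ℓ
  a+b≡1+ℓ = trans (+-comm a b) (m∸n+n≡m a≤1+ℓ)
  no-cell-on-diagonal-ℓ+1 : ∀ {s t} → 1 ≤ s → s ≤ suc ℓ → s + t ≡ suc (suc ℓ) → 1 ≤ t → t ≤ at F s → ⊥
  no-cell-on-diagonal-ℓ+1 {s} {t} 1≤s s≤ s+t 1≤t t≤ = <⇒≢ (≤-trans
    (count-positive (oneTo (suc ℓ)) (∈oneTo⁺ 1≤s s≤)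
       (subst (λ z → inF F (s , z) ≡ true) (sym (trans (cong (_∸ s) (sym s+t)) (m+n∸m≡n s t))) (inF-true {F} 1≤t t≤)))
    (≤-reflexive (beyond (suc ℓ) (n<1+n ℓ)))) refl
  Fa≡b : at F a ≡ b
  Fa≡b with m≤n⇒m<n∨m≡n b≤Fa
  ... | inj₂ e = sym e
  ... | inj₁ b<Fa = ⊥-elim (no-cell-on-diagonal-ℓ+1 1≤a a≤1+ℓ (trans (+-suc a b) (cong suc a+b≡1+ℓ)) (s≤s z≤n) b<Fa)
  below : ∀ s → a < s → at F s < b
  below s a<s = ≤-<-trans (IsFerrers-antitone {F} fer (s≤s z≤n) a<s) below-a
    where
    below-a : at F (suc a) < b
    below-a with at F (suc a) <? b
    ... | yes p = p
    ... | no np = ⊥-elim (no-cell-on-diagonal-ℓ+1 (s≤s z≤n) (s≤s a≤ℓ) (cong suc a+b≡1+ℓ) 1≤b (≮⇒≥ np))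

shift-cong : ∀ n {p q : Poly} → p ≈ₚ q → shift n p ≈ₚ shift n q
shift-cong n p≈q k with k <ᵇ n
... | true  = refl
... | false = p≈q (k ∸ n)

shift-0ₚ : ∀ n {p : Poly} → p ≈ₚ 0ₚ → shift n p ≈ₚ 0ₚ
shift-0ₚ n p≈0 k with k <ᵇ n
... | true  = refl
... | false = p≈0 (k ∸ n)

shift-1-shift : ∀ n (p : Poly) → shift 1 (shift n p) ≈ₚ shift (suc n) p
shift-1-shift n p zero    = refl
shift-1-shift n p (suc k) = refl

shift-1-⊕ : ∀ (p q : Poly) → shift 1 (p ⊕ q) ≈ₚ (shift 1 p ⊕ shift 1 q)
shift-1-⊕ p q zero    = refl
shift-1-⊕ p q (suc k) = refl

shift-1-sumₚ : ∀ n (f : ℕ → Poly) → shift 1 (sumₚ n f) ≈ₚ sumₚ n (λ j → shift 1 (f j))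
shift-1-sumₚ zero    f zero    = refl
shift-1-sumₚ zero    f (suc k) = refl
shift-1-sumₚ (suc n) f k = trans (shift-1-⊕ (sumₚ n f) (f (suc n)) k) (cong (_+ shift 1 (f (suc n)) k) (shift-1-sumₚ n f k))

shift-qpow : ∀ n s → shift n (qpow s) ≈ₚ qpow (s + n)
shift-qpow n s k with k <? n
... | yes k<n rewrite <ᵇ-true k<n | ≡ᵇ-false {s + n} {k} (λ e → <⇒≱ k<n (≤-trans (m≤n+m n s) (≤-reflexive e))) = refl
... | no k≮n rewrite <ᵇ-false (≮⇒≥ k≮n) = cong ind (Bool-≡ (≡ᵇ-true ∘ to) (≡ᵇ-true ∘ from))
  where
  to : (s ≡ᵇ k ∸ n) ≡ true → s + n ≡ k
  to e = trans (cong (_+ n) (≡ᵇ-sound {s} e)) (m∸n+n≡m (≮⇒≥ k≮n))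
  from : (s + n ≡ᵇ k) ≡ true → s ≡ k ∸ n
  from e = trans (sym (m+n∸n≡m s n)) (cong (_∸ n) (≡ᵇ-sound {s + n} e))

sumₚ-cong : ∀ n {f g : ℕ → Poly} → (∀ j → 1 ≤ j → j ≤ n → f j ≈ₚ g j) → sumₚ n f ≈ₚ sumₚ n g
sumₚ-cong zero    h k = refl
sumₚ-cong (suc n) h k = cong₂ _+_ (sumₚ-cong n (λ j 1≤j j≤n → h j 1≤j (m≤n⇒m≤1+n j≤n)) k) (h (suc n) (s≤s z≤n) ≤-refl k)

sumₚ-0ₚ : ∀ n {f : ℕ → Poly} → (∀ j → 1 ≤ j → j ≤ n → f j ≈ₚ 0ₚ) → sumₚ n f ≈ₚ 0ₚ
sumₚ-0ₚ zero    h k = refl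
sumₚ-0ₚ (suc n) h k = cong₂ _+_ (sumₚ-0ₚ n (λ j 1≤j j≤n → h j 1≤j (m≤n⇒m≤1+n j≤n)) k) (h (suc n) (s≤s z≤n) ≤-refl k)

shift-1-extend : ∀ m (p t : Poly) (f g : ℕ → Poly) →
  (∀ j → 1 ≤ j → j ≤ m → shift 1 (f j) ≈ₚ g j) → t ≈ₚ g (suc m) →
  (shift 1 (shift m p ⊕ sumₚ m f) ⊕ t) ≈ₚ (shift (suc m) p ⊕ sumₚ (suc m) g)
shift-1-extend m p t f g f≈g t≈g k = begin
  shift 1 (shift m p ⊕ sumₚ m f) k + t k
    ≡⟨ cong (_+ t k) (shift-1-⊕ (shift m p) (sumₚ m f) k) ⟩
  (shift 1 (shift m p) k + shift 1 (sumₚ m f) k) + t k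
    ≡⟨ cong₂ (λ u v → (u + v) + t k) (shift-1-shift m p k) (trans (shift-1-sumₚ m f k) (sumₚ-cong m f≈g k)) ⟩
  (shift (suc m) p k + sumₚ m g k) + t k
    ≡⟨ +-assoc (shift (suc m) p k) _ _ ⟩
  shift (suc m) p k + (sumₚ m g k + t k)
    ≡⟨ cong (λ z → shift (suc m) p k + (sumₚ m g k + z)) (t≈g k) ⟩
  shift (suc m) p k + sumₚ (suc m) g k ∎

-- Peeling off the last diagonal

record Peeling (m ℓ : ℕ) (F : List ℕ) : Set where
  field
    rest       : List ℕ
    struck     : ℕ → List ℕ
    truncation : Truncation ℓ F rest
    stripped   : ∀ j → 1 ≤ j → j ≤ m → Stripped ℓ j F (struck j)
    recurrence : ∀ r → Rℕ r F ≈ₚ (shift m (Rℕ r rest) ⊕ sumₚ m (λ j → shift (m ∸ j) (Rpred r (struck j))))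

peel : ∀ m ℓ F → IsFerrers F → (∀ j → ℓ < j → diag F j ≡ 0) → diag F ℓ ≡ m → Peeling m ℓ F
peel zero ℓ F fer beyond dℓ≡0 = record
  { rest       = F
  ; struck     = λ _ → []
  ; truncation = record { ferrers = fer ; agrees = λ _ _ → refl ; empty = empty }
  ; stripped   = λ { (suc _) _ () }
  ; recurrence = λ r k → sym (+-identityʳ _)
  }
  where
  empty : ∀ i → ℓ ≤ i → diag F i ≡ 0
  empty i ℓ≤i with m≤n⇒m<n∨m≡n ℓ≤i
  ... | inj₁ ℓ<i = beyond i ℓ<i
  ... | inj₂ refl = dℓ≡0
peel (suc m) ℓ F fer beyond dℓ≡1+m with lastDiagonalCorner F ℓ m fer beyond dℓ≡1+m
... | a , b , 1≤a , 1≤b , a+b≡1+ℓ , Fa≡b , below = record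
  { rest       = rest
  ; struck     = struck′
  ; truncation = truncation-F⁻ truncation
  ; stripped   = stripped′
  ; recurrence = λ r k → begin
      Rℕ r F k
        ≡⟨ corner-recurrence r k ⟩
      shift 1 (Rℕ r F⁻) k + Rpred r H k
        ≡⟨ cong (_+ Rpred r H k) (shift-cong 1 (recurrence r) k) ⟩
      shift 1 (shift m (Rℕ r rest) ⊕ sumₚ m (λ j → shift (m ∸ j) (Rpred r (struck j)))) k + Rpred r H k
        ≡⟨ shift-1-extend m (Rℕ r rest) (Rpred r H) _ _ (shift-earlier r) (last-term r) k ⟩
      (shift (suc m) (Rℕ r rest) ⊕ sumₚ (suc m) (λ j → shift (suc m ∸ j) (Rpred r (struck′ j)))) k ∎
  }
  where
  open CornerOnDiagonal F fer ℓ a b 1≤a 1≤b a+b≡1+ℓ Fa≡b below beyond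
  open Peeling (peel m ℓ F⁻ F⁻-Ferrers
                  (λ j ℓ<j → trans (diag-F⁻-≢ j (λ e → <-irrefl (sym e) ℓ<j)) (beyond j ℓ<j))
                  (suc-injective (trans (sym diag-F⁻-ℓ) dℓ≡1+m)))
  struck′ : ℕ → List ℕ
  struck′ j = if j ≡ᵇ suc m then H else struck j
  struck′-earlier : ∀ j → j ≤ m → struck′ j ≡ struck j
  struck′-earlier j j≤m rewrite ≡ᵇ-false {j} {suc m} (λ e → <-irrefl e (s≤s j≤m)) = refl
  struck′-last : struck′ (suc m) ≡ H
  struck′-last rewrite ≡ᵇ-true {m} refl = refl
  stripped′ : ∀ j → 1 ≤ j → j ≤ suc m → Stripped ℓ j F (struck′ j)
  stripped′ j 1≤j j≤1+m with m≤n⇒m<n∨m≡n j≤1+m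
  ... | inj₁ (s≤s j≤m) rewrite struck′-earlier j j≤m = stripped-F⁻ (stripped j 1≤j j≤m)
  ... | inj₂ refl rewrite struck′-last = H-stripped dℓ≡1+m
  shift-earlier : ∀ r j → 1 ≤ j → j ≤ m →
    shift 1 (shift (m ∸ j) (Rpred r (struck j))) ≈ₚ shift (suc m ∸ j) (Rpred r (struck′ j))
  shift-earlier r j _ j≤m rewrite struck′-earlier j j≤m | +-∸-assoc 1 j≤m = shift-1-shift (m ∸ j) (Rpred r (struck j))
  last-term : ∀ r → Rpred r H ≈ₚ shift (suc m ∸ suc m) (Rpred r (struck′ (suc m)))
  last-term r k rewrite struck′-last | n∸n≡0 m = refl

at-∷ʳ-< : ∀ ds x i → i ≤ length ds → at (ds ∷ʳ x) i ≡ at ds i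
at-∷ʳ-< []       x zero          _ = refl
at-∷ʳ-< (d ∷ ds) x zero          _ = refl
at-∷ʳ-< (d ∷ ds) x (suc zero)    _ = refl
at-∷ʳ-< (d ∷ ds) x (suc (suc i)) (s≤s i≤) = at-∷ʳ-< ds x (suc i) i≤

at-∷ʳ-last : ∀ ds x → at (ds ∷ʳ x) (suc (length ds)) ≡ x
at-∷ʳ-last []           x = refl
at-∷ʳ-last (d ∷ [])     x = refl
at-∷ʳ-last (d ∷ e ∷ ds) x = at-∷ʳ-last (e ∷ ds) x

at-beyond : ∀ d i → length d < i → at d i ≡ 0
at-beyond []      i _ = refl
at-beyond (x ∷ d) (suc (suc i)) (s≤s d<i) = at-beyond d (suc i) d<i

at-map-∸1 : ∀ xs i → at (map (_∸ 1) xs) i ≡ at xs i ∸ 1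
at-map-∸1 []       i             = refl
at-map-∸1 (x ∷ xs) zero          = refl
at-map-∸1 (x ∷ xs) (suc zero)    = refl
at-map-∸1 (x ∷ xs) (suc (suc i)) = at-map-∸1 xs (suc i)

length-∷ʳ : ∀ (ds : List ℕ) x → length (ds ∷ʳ x) ≡ suc (length ds)
length-∷ʳ ds x = trans (length-++ ds) (+-comm (length ds) 1)

sumL-∷ʳ : ∀ ds x → sumL (ds ∷ʳ x) ≡ sumL ds + x
sumL-∷ʳ []       x = +-identityʳ x
sumL-∷ʳ (d ∷ ds) x = trans (cong (d +_) (sumL-∷ʳ ds x)) (sym (+-assoc d _ x))

sumL-tailPred : ∀ ds → sumL (tailPred ds) ≤ sumL ds
sumL-tailPred []       = z≤n
sumL-tailPred (d ∷ ds) = ≤-trans (sumL-map∸1 ds) (m≤n+m _ d)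
  where
  sumL-map∸1 : ∀ xs → sumL (map (_∸ 1) xs) ≤ sumL xs
  sumL-map∸1 []       = z≤n
  sumL-map∸1 (x ∷ xs) = +-mono-≤ (m∸n≤m x 1) (sumL-map∸1 xs)

length-tailPred : ∀ ds → length (tailPred ds) ≤ length ds
length-tailPred []       = z≤n
length-tailPred (d ∷ ds) = ≤-trans (≤-reflexive (length-map (_∸ 1) ds)) (n≤1+n _)

∈⇒≤∂ : ∀ {y} d → y ∈ d → y ≤ ∂ d
∈⇒≤∂ (x ∷ d) (here refl) = m≤m⊔n x _
∈⇒≤∂ (x ∷ d) (there m)   = ≤-trans (∈⇒≤∂ d m) (m≤n⊔m x _)

∂-least : ∀ d c → (∀ {y} → y ∈ d → y ≤ c) → ∂ d ≤ c
∂-least []      c h = z≤n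
∂-least (x ∷ d) c h = ⊔-lub (h (here refl)) (∂-least d c (h ∘ there))

∂-init : ∀ ds x → ∂ ds ≤ ∂ (ds ∷ʳ x)
∂-init ds x = ∂-least ds _ (λ m → ∈⇒≤∂ (ds ∷ʳ x) (∈-++⁺ˡ m))

∂-last : ∀ ds x → x ≤ ∂ (ds ∷ʳ x)
∂-last ds x = ∈⇒≤∂ (ds ∷ʳ x) (∈-++⁺ʳ ds (here refl))

∈tailPred⁻ : ∀ {y} ds → y ∈ tailPred ds → Σ ℕ λ z → z ∈ ds × y ≡ z ∸ 1
∈tailPred⁻ (d ∷ es) m with ∈-map⁻ (_∸ 1) m
... | z , z∈ , refl = z , there z∈ , refl

∂-gseq : ∀ ds x j → j ≤ x → ∂ (gseq ds j) ≤ ∂ (ds ∷ʳ x) ∸ 1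
∂-gseq ds x j j≤x = ∂-least (gseq ds j) _ bounded
  where
  bounded : ∀ {y} → y ∈ gseq ds j → y ≤ ∂ (ds ∷ʳ x) ∸ 1
  bounded m with ∈-++⁻ (tailPred ds) m
  ... | inj₂ (here refl) = ∸-monoˡ-≤ 1 (≤-trans j≤x (∂-last ds x))
  bounded m | inj₁ m′ with ∈tailPred⁻ ds m′
  ... | z , z∈ , refl = ∸-monoˡ-≤ 1 (∈⇒≤∂ (ds ∷ʳ x) (∈-++⁺ˡ z∈))

μ : List ℕ → ℕ
μ d = sumL d + length d

_⊏_ : List ℕ → List ℕ → Set
d ⊏ e = μ d < μ e

⊏-wellFounded : WellFounded _⊏_
⊏-wellFounded = On.wellFounded μ <-wellFounded

μ-∷ʳ : ∀ ds x → μ (ds ∷ʳ x) ≡ (sumL ds + x) + suc (length ds)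
μ-∷ʳ ds x = cong₂ _+_ (sumL-∷ʳ ds x) (length-∷ʳ ds x)

init-⊏ : ∀ ds x → ds ⊏ (ds ∷ʳ x)
init-⊏ ds x = ≤-trans (s≤s (+-monoˡ-≤ (length ds) (m≤m+n (sumL ds) x)))
                      (≤-reflexive (trans (sym (+-suc _ (length ds))) (sym (μ-∷ʳ ds x))))

gseq-⊏ : ∀ ds x j → 1 ≤ j → j ≤ x → gseq ds j ⊏ (ds ∷ʳ x)
gseq-⊏ ds x j 1≤j j≤x = subst₂ _<_ (sym (μ-∷ʳ (tailPred ds) (j ∸ 1))) (sym (μ-∷ʳ ds x))
  (+-mono-<-≤ (+-mono-≤-< (sumL-tailPred ds) (<-≤-trans (∸1< 1≤j) j≤x)) (s≤s (length-tailPred ds)))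

module Realization (ds : List ℕ) (x : ℕ) (F : List ℕ) (real : Realizes F (ds ∷ʳ x)) where

  ℓ : ℕ
  ℓ = suc (length ds)

  beyond : ∀ j → ℓ < j → diag F j ≡ 0
  beyond j ℓ<j = trans (real j (≤-trans (s≤s z≤n) ℓ<j)) (at-beyond (ds ∷ʳ x) j (subst (_< j) (sym (length-∷ʳ ds x)) ℓ<j))

  last-diagonal : diag F ℓ ≡ x
  last-diagonal = trans (real ℓ (s≤s z≤n)) (at-∷ʳ-last ds x)

  earlier-diagonal : ∀ i → 1 ≤ i → i < ℓ → diag F i ≡ at ds i
  earlier-diagonal i 1≤i (s≤s i≤) = trans (real i 1≤i) (at-∷ʳ-< ds x i i≤)

  truncation-realizes : ∀ {G} → Truncation ℓ F G → Realizes G ds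
  truncation-realizes tr i 1≤i with i <? ℓ
  ... | yes i<ℓ = trans (Truncation.agrees tr i i<ℓ) (earlier-diagonal i 1≤i i<ℓ)
  ... | no i≮ℓ  = trans (Truncation.empty tr i (≮⇒≥ i≮ℓ)) (sym (at-beyond ds i (≮⇒≥ i≮ℓ)))

diag-1≤1 : ∀ F → diag F 1 ≤ 1
diag-1≤1 F with inF F (1 , 1)
... | true  = ≤-refl
... | false = z≤n

stripped-realizes : ∀ ds x F → Realizes F (ds ∷ʳ x) →
  ∀ {j G} → j ≤ x → Stripped (suc (length ds)) j F G → Realizes G (gseq ds j)
stripped-realizes [] x F real {j} j≤x S i 1≤i = trans (Stripped.empty S i 1≤i) (sym (at-[j∸1] i))
  where
  open Realization [] x F real using (last-diagonal)
  at-[j∸1] : ∀ i → at [ j ∸ 1 ] i ≡ 0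
  at-[j∸1] zero          = refl
  at-[j∸1] (suc zero)    = n≤0⇒n≡0 (∸-monoˡ-≤ 1 (≤-trans j≤x (≤-trans (≤-reflexive (sym last-diagonal)) (diag-1≤1 F))))
  at-[j∸1] (suc (suc i)) = refl
stripped-realizes (d ∷ es) x F real {j} {G} j≤x S (suc i) _ with suc i ≤? length es
... | yes 1+i≤ = begin
  diag G (suc i)                      ≡⟨ Stripped.lowered S (suc i) (s≤s (s≤s 1+i≤)) ⟩
  diag F (suc (suc i)) ∸ 1           ≡⟨ cong (_∸ 1) (earlier-diagonal (suc (suc i)) (s≤s z≤n) (s≤s (s≤s 1+i≤))) ⟩
  at es (suc i) ∸ 1                  ≡⟨ sym (at-map-∸1 es (suc i)) ⟩
  at es⁻ (suc i)                     ≡⟨ sym (at-∷ʳ-< es⁻ (j ∸ 1) (suc i) (subst (suc i ≤_) (sym (length-map (_∸ 1) es)) 1+i≤)) ⟩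
  at (es⁻ ∷ʳ (j ∸ 1)) (suc i)        ∎
  where
  open Realization (d ∷ es) x F real using (earlier-diagonal)
  es⁻ : List ℕ
  es⁻ = map (_∸ 1) es
... | no 1+i≰ with suc i ≟ suc (length es)
...   | yes 1+i≡ = begin
  diag G (suc i)                                      ≡⟨ Stripped.last S (suc i) (cong suc 1+i≡) ⟩
  j ∸ 1                                               ≡⟨ sym (at-∷ʳ-last es⁻ (j ∸ 1)) ⟩
  at (es⁻ ∷ʳ (j ∸ 1)) (suc (length es⁻))              ≡⟨ cong (at (es⁻ ∷ʳ (j ∸ 1))) (trans (cong suc (length-map (_∸ 1) es)) (sym 1+i≡)) ⟩
  at (es⁻ ∷ʳ (j ∸ 1)) (suc i)                         ∎
  where
  es⁻ : List ℕ
  es⁻ = map (_∸ 1) es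
...   | no 1+i≢ = trans (Stripped.empty S (suc i) ℓ<1+i)
                        (sym (at-beyond (es⁻ ∷ʳ (j ∸ 1)) (suc i) (subst (_< suc i) (sym length-es⁻∷ʳ) (<-≤-trans (s≤s (s≤s ≤-refl)) ℓ<1+i))))
  where
  es⁻ : List ℕ
  es⁻ = map (_∸ 1) es
  ℓ<1+i : suc (suc (length es)) ≤ suc i
  ℓ<1+i = ≤∧≢⇒< (≰⇒> 1+i≰) (1+i≢ ∘ sym)
  length-es⁻∷ʳ : length (es⁻ ∷ʳ (j ∸ 1)) ≡ suc (length es)
  length-es⁻∷ʳ = trans (length-∷ʳ es⁻ (j ∸ 1)) (cong suc (length-map (_∸ 1) es))

record PeeledRealization (ds : List ℕ) (x : ℕ) (F : List ℕ) : Set where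
  field
    rest            : List ℕ
    rest-ferrers    : IsFerrers rest
    rest-realizes   : Realizes rest ds
    struck          : ℕ → List ℕ
    struck-ferrers  : ∀ j → 1 ≤ j → j ≤ x → IsFerrers (struck j)
    struck-realizes : ∀ j → 1 ≤ j → j ≤ x → Realizes (struck j) (gseq ds j)
    recurrence      : ∀ r → Rℕ r F ≈ₚ (shift x (Rℕ r rest) ⊕ sumₚ x (λ j → shift (x ∸ j) (Rpred r (struck j))))

peelRealization : ∀ ds x F → IsFerrers F → Realizes F (ds ∷ʳ x) → PeeledRealization ds x F
peelRealization ds x F fer real = record
  { rest            = rest
  ; rest-ferrers    = Truncation.ferrers truncation
  ; rest-realizes   = truncation-realizes truncation
  ; struck          = struck
  ; struck-ferrers  = λ j 1≤j j≤x → Stripped.ferrers (stripped j 1≤j j≤x)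
  ; struck-realizes = λ j 1≤j j≤x → stripped-realizes ds x F real j≤x (stripped j 1≤j j≤x)
  ; recurrence      = recurrence
  }
  where
  open Realization ds x F real
  open Peeling (peel x ℓ F fer beyond last-diagonal)

cells-empty : ∀ F → Realizes F [] → cells F ≡ []
cells-empty F real = cellsFrom-empty 1 F rows-empty
  where
  rows-empty : ∀ s → at F (suc s) ≡ 0
  rows-empty s with at F (suc s) ≟ 0
  ... | yes Fs≡0 = Fs≡0
  ... | no Fs≢0 = ⊥-elim (<⇒≢ (≤-trans
          (count-positive (oneTo (suc s)) (∈oneTo⁺ (s≤s z≤n) ≤-refl)
             (subst (λ t → inF F (suc s , t) ≡ true) (sym (m+n∸n≡m 1 (suc s))) (inF-true {F} ≤-refl (n≢0⇒n>0 Fs≢0))))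
          (≤-reflexive (real (suc s) (s≤s z≤n)))) refl)
  cellsFrom-empty : ∀ i F → (∀ s → at F (suc s) ≡ 0) → cellsFrom i F ≡ []
  cellsFrom-empty i []      h = refl
  cellsFrom-empty i (x ∷ F) h with h 0
  ... | refl = cellsFrom-empty (suc i) F (h ∘ suc)

Rℕ-cells : ∀ r F₁ F₂ → cells F₁ ≡ cells F₂ → Rℕ r F₁ ≈ₚ Rℕ r F₂
Rℕ-cells r F₁ F₂ e k = cong (λ C → countSubs (isPlacement r C k) C) e

-- Induction on the diagonal sequence

R-independent : ∀ d → Acc _⊏_ d → ∀ F₁ F₂ → IsFerrers F₁ → IsFerrers F₂ → Realizes F₁ d → Realizes F₂ d →
  ∀ r → Rℕ r F₁ ≈ₚ Rℕ r F₂
R-independent d (acc smaller) F₁ F₂ fer₁ fer₂ real₁ real₂ r with initLast d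
... | [] = Rℕ-cells r F₁ F₂ (trans (cells-empty F₁ real₁) (sym (cells-empty F₂ real₂)))
... | ds ∷ʳ′ x = λ k → begin
  Rℕ r F₁ k
    ≡⟨ P₁.recurrence r k ⟩
  shift x (Rℕ r P₁.rest) k + sumₚ x (λ j → shift (x ∸ j) (Rpred r (P₁.struck j))) k
    ≡⟨ cong₂ _+_ (shift-cong x rest-same k) (sumₚ-cong x (λ j 1≤j j≤x → shift-cong (x ∸ j) (struck-same r j 1≤j j≤x)) k) ⟩
  shift x (Rℕ r P₂.rest) k + sumₚ x (λ j → shift (x ∸ j) (Rpred r (P₂.struck j))) k
    ≡⟨ sym (P₂.recurrence r k) ⟩
  Rℕ r F₂ k ∎
  where
  module P₁ = PeeledRealization (peelRealization ds x F₁ fer₁ real₁)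
  module P₂ = PeeledRealization (peelRealization ds x F₂ fer₂ real₂)
  rest-same : Rℕ r P₁.rest ≈ₚ Rℕ r P₂.rest
  rest-same = R-independent ds (smaller {ds} (init-⊏ ds x)) P₁.rest P₂.rest P₁.rest-ferrers P₂.rest-ferrers P₁.rest-realizes P₂.rest-realizes r
  struck-same : ∀ r j → 1 ≤ j → j ≤ x → Rpred r (P₁.struck j) ≈ₚ Rpred r (P₂.struck j)
  struck-same zero    j 1≤j j≤x k = refl
  struck-same (suc r) j 1≤j j≤x =
    R-independent (gseq ds j) (smaller {gseq ds j} (gseq-⊏ ds x j 1≤j j≤x)) (P₁.struck j) (P₂.struck j)
      (P₁.struck-ferrers j 1≤j j≤x) (P₂.struck-ferrers j 1≤j j≤x) (P₁.struck-realizes j 1≤j j≤x) (P₂.struck-realizes j 1≤j j≤x) r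

R-recurrence : ∀ ds x F → IsFerrers F → Realizes F (ds ∷ʳ x) →
  ∀ F′ → IsFerrers F′ → Realizes F′ ds →
  ∀ (G : ℕ → List ℕ) → (∀ j → 1 ≤ j → j ≤ x → IsFerrers (G j) × Realizes (G j) (gseq ds j)) →
  ∀ r → Rℕ r F ≈ₚ (shift x (Rℕ r F′) ⊕ sumₚ x (λ j → shift (x ∸ j) (Rpred r (G j))))
R-recurrence ds x F fer real F′ fer′ real′ G G-realizes r k = begin
  Rℕ r F k
    ≡⟨ P.recurrence r k ⟩
  shift x (Rℕ r P.rest) k + sumₚ x (λ j → shift (x ∸ j) (Rpred r (P.struck j))) k
    ≡⟨ cong₂ _+_ (shift-cong x rest-same k) (sumₚ-cong x (λ j 1≤j j≤x → shift-cong (x ∸ j) (struck-same r j 1≤j j≤x)) k) ⟩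
  shift x (Rℕ r F′) k + sumₚ x (λ j → shift (x ∸ j) (Rpred r (G j))) k ∎
  where
  module P = PeeledRealization (peelRealization ds x F fer real)
  rest-same : Rℕ r P.rest ≈ₚ Rℕ r F′
  rest-same = R-independent ds (⊏-wellFounded ds) P.rest F′ P.rest-ferrers fer′ P.rest-realizes real′ r
  struck-same : ∀ r j → 1 ≤ j → j ≤ x → Rpred r (P.struck j) ≈ₚ Rpred r (G j)
  struck-same zero    j 1≤j j≤x k = refl
  struck-same (suc r) j 1≤j j≤x = R-independent (gseq ds j) (⊏-wellFounded (gseq ds j)) (P.struck j) (G j)
    (P.struck-ferrers j 1≤j j≤x) (proj₁ (G-realizes j 1≤j j≤x)) (P.struck-realizes j 1≤j j≤x) (proj₂ (G-realizes j 1≤j j≤x)) r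

R₀-realization : ∀ d → Acc _⊏_ d → ∀ F → IsFerrers F → Realizes F d → Rℕ 0 F ≈ₚ qpow (sumL d)
R₀-realization d (acc smaller) F fer real with initLast d
... | [] = λ k → trans (Rℕ-cells 0 F [] (cells-empty F real) k) (R₀-empty k)
  where
  R₀-empty : Rℕ 0 [] ≈ₚ qpow 0
  R₀-empty zero    = refl
  R₀-empty (suc k) = refl
... | ds ∷ʳ′ x = λ k → begin
  Rℕ 0 F k
    ≡⟨ P.recurrence 0 k ⟩
  shift x (Rℕ 0 P.rest) k + sumₚ x (λ j → shift (x ∸ j) 0ₚ) k
    ≡⟨ cong₂ _+_ (shift-cong x rest-R₀ k) (sumₚ-0ₚ x (λ j _ _ → shift-0ₚ (x ∸ j) (λ _ → refl)) k) ⟩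
  shift x (qpow (sumL ds)) k + 0
    ≡⟨ +-identityʳ _ ⟩
  shift x (qpow (sumL ds)) k
    ≡⟨ shift-qpow x (sumL ds) k ⟩
  qpow (sumL ds + x) k
    ≡⟨ cong (λ n → qpow n k) (sym (sumL-∷ʳ ds x)) ⟩
  qpow (sumL (ds ∷ʳ x)) k ∎
  where
  module P = PeeledRealization (peelRealization ds x F fer real)
  rest-R₀ : Rℕ 0 P.rest ≈ₚ qpow (sumL ds)
  rest-R₀ = R₀-realization ds (smaller {ds} (init-⊏ ds x)) P.rest P.rest-ferrers P.rest-realizes

R-vanishes : ∀ d → Acc _⊏_ d → ∀ F → IsFerrers F → Realizes F d → ∀ r → ∂ d < r → Rℕ r F ≈ₚ 0ₚ
R-vanishes d (acc smaller) F fer real r ∂<r with initLast d | r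
... | []       | suc r′ = Rℕ-cells (suc r′) F [] (cells-empty F real)
... | ds ∷ʳ′ x | suc r′ = λ k → trans (P.recurrence (suc r′) k)
  (cong₂ _+_ (shift-0ₚ x rest-vanishes k) (sumₚ-0ₚ x (λ j 1≤j j≤x → shift-0ₚ (x ∸ j) (struck-vanishes j 1≤j j≤x)) k))
  where
  module P = PeeledRealization (peelRealization ds x F fer real)
  rest-vanishes : Rℕ (suc r′) P.rest ≈ₚ 0ₚ
  rest-vanishes = R-vanishes ds (smaller {ds} (init-⊏ ds x)) P.rest P.rest-ferrers P.rest-realizes (suc r′)
                    (≤-<-trans (∂-init ds x) ∂<r)
  struck-vanishes : ∀ j → 1 ≤ j → j ≤ x → Rℕ r′ (P.struck j) ≈ₚ 0ₚ
  struck-vanishes j 1≤j j≤x = R-vanishes (gseq ds j) (smaller {gseq ds j} (gseq-⊏ ds x j 1≤j j≤x)) (P.struck j)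
    (P.struck-ferrers j 1≤j j≤x) (P.struck-realizes j 1≤j j≤x) r′
    (≤-<-trans (∂-gseq ds x j j≤x) (<-≤-trans (∸1< (≤-trans 1≤j (≤-trans j≤x (∂-last ds x)))) (≤-pred ∂<r)))

open import Data.Integer using (ℤ; +_; -[1+_]; _-_; +≤+; +<+) renaming (_≤_ to _≤ℤ_; _<_ to _<ℤ_)

theorem3p5 : (r : ℤ) (ds : List ℕ) (dℓ : ℕ)
    → IsFerrersSeq (ds ∷ʳ dℓ)
    → (F : List ℕ) → IsFerrers F → Realizes F (ds ∷ʳ dℓ)
    → ((F' : List ℕ) → IsFerrers F' → Realizes F' ds
       → (G : ℕ → List ℕ)
       → (∀ j → 1 ≤ j → j ≤ dℓ → IsFerrers (G j) × Realizes (G j) (gseq ds j))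
       → + 1 ≤ℤ r → r ≤ℤ + ∂ (ds ∷ʳ dℓ)
       → R r F ≈ₚ (shift dℓ (R r F') ⊕ sumₚ dℓ (λ j → shift (dℓ ∸ j) (R (r - + 1) (G j)))))
      × (R (+ 0) F ≈ₚ qpow (sumL (ds ∷ʳ dℓ)))
      × ((+ ∂ (ds ∷ʳ dℓ) <ℤ r ⊎ r <ℤ + 0) → R r F ≈ₚ 0ₚ)
theorem3p5 r ds dℓ _ F fer real = recurrence r , R₀ , vanishing r
  where
  recurrence : ∀ r F′ → IsFerrers F′ → Realizes F′ ds → ∀ G → (∀ j → 1 ≤ j → j ≤ dℓ → IsFerrers (G j) × Realizes (G j) (gseq ds j)) →
    + 1 ≤ℤ r → r ≤ℤ + ∂ (ds ∷ʳ dℓ) → R r F ≈ₚ (shift dℓ (R r F′) ⊕ sumₚ dℓ (λ j → shift (dℓ ∸ j) (R (r - + 1) (G j))))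
  -- R (+ suc r - + 1) computes to Rℕ r, which is Rpred (suc r).
  recurrence (+ suc r) F′ fer′ real′ G G-realizes _ _ = R-recurrence ds dℓ F fer real F′ fer′ real′ G G-realizes (suc r)
  recurrence (+ zero)  _ _ _ _ _ (+≤+ ()) _
  R₀ : R (+ 0) F ≈ₚ qpow (sumL (ds ∷ʳ dℓ))
  R₀ = R₀-realization (ds ∷ʳ dℓ) (⊏-wellFounded _) F fer real
  vanishing : ∀ r → (+ ∂ (ds ∷ʳ dℓ) <ℤ r ⊎ r <ℤ + 0) → R r F ≈ₚ 0ₚ
  vanishing (+ r)    (inj₁ (+<+ ∂<r)) = R-vanishes (ds ∷ʳ dℓ) (⊏-wellFounded _) F fer real r ∂<r
  vanishing (+ r)    (inj₂ (+<+ ()))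
  vanishing -[1+ r ] _                 = λ _ → refl
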